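{- Let $T=(\Sigma,\mathcal{R})$ be a graph transformation system and $\mathcal{D}\subseteq\mathcal{G}(\Sigma)$ a graph language. If all $\mathcal{D}$-non-garbage critical pairs of $T$ are strongly subcommutative, then $T$ is subcommutative up to garbage on $\mathcal{D}$.
   Context: A signature $\Sigma=(\Sigma_V,\Sigma_E)$ is a pair of finite label sets; graphs over $\Sigma$ are finite directed graphs with node labels in $\Sigma_V$ and edge labels in $\Sigma_E$; $\mathcal{G}(\Sigma)$ is the class of all of them. A graph language is an isomorphism-closed class of graphs; $\widehat{\mathcal{D}}$ is the smallest language containing $\mathcal{D}$ that is closed under taking subgraphs. A rule is a pair of inclusions $r=\langle L\leftarrow K\rightarrow R\rangle$; a GT system $T=(\Sigma,\mathcal{R})$ has a finite rule set. A direct derivation $G\Rightarrow_{r,g}H$ applies $r$ at an injective match $g:L\to G$ via a double pushout $L\leftarrow K\rightarrow R$ over $G\xleftarrow{in}D\xrightarrow{in'}H$; the track morphism is the partial morphism $in'\circ in^{ -1}$, composed along derivations. $G\Rightarrow^=_\mathcal{R}H$ means $G\cong H$ or $G\Rightarrow_\mathcal{R}H$. Direct derivations $H_1\Leftarrow_{r_1,g_1}G\Rightarrow_{r_2,g_2}H_2$ are parallelly independent if $g_1(L_1)\cap g_2(L_2)\subseteq g_1(K_1)\cap g_2(K_2)$; they form a critical pair if not parallelly independent, $G=g_1(L_1)\cup g_2(L_2)$, and $g_1\neq g_2$ when $r_1=r_2$. Persistent nodes: nodes of $G$ whose tracks under both steps are defined. The critical pair is strongly subcommutative if there are $M$ and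 $H_1\Rightarrow^=_\mathcal{R}M\Leftarrow^=_\mathcal{R}H_2$ such that every persistent node has defined and equal tracks along $G\Rightarrow H_1\Rightarrow^=M$ and $G\Rightarrow H_2\Rightarrow^=M$. It is $\mathcal{D}$-non-garbage if $G\in\widehat{\mathcal{D}}$. $T$ is subcommutative up to garbage on $\mathcal{D}$ if for all $G\in\mathcal{D}$, $H_1\Leftarrow_\mathcal{R}G\Rightarrow_\mathcal{R}H_2$ implies there is $M$ with $H_1\Rightarrow^=_\mathcal{R}M\Leftarrow^=_\mathcal{R}H_2$. -}

module Defs where

open import Data.Nat using (ℕ)
open import Data.Fin using (Fin)
open import Data.Product using (Σ; ∃; _×_; _,_)
open import Data.Sum using (_⊎_)
open import Relation.Nullary using (¬_)
open import Relation.Binary.PropositionalEquality using (_≡_; subst; cong)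

record Signature : Set where
  field
    nV : ℕ
    nE : ℕ

module _ (S : Signature) where
  open Signature S

  record Graph : Set where
    field
      V   : ℕ
      E   : ℕ
      src : Fin E → Fin V
      tgt : Fin E → Fin V
      lV  : Fin V → Fin nV
      lE  : Fin E → Fin nE

  open Graph

  record Hom (G H : Graph) : Set where
    field
      fV    : Fin (V G) → Fin (V H)
      fE    : Fin (E G) → Fin (E H)
      f-src : ∀ e → fV (src G e) ≡ src H (fE e)
      f-tgt : ∀ e → fV (tgt G e) ≡ tgt H (fE e)
      f-lV  : ∀ v → lV H (fV v) ≡ lV G v
      f-lE  : ∀ e → lE H (fE e) ≡ lE G e

  open Hom

  idH : ∀ {G} → Hom G G
  idH = record { fV = λ v → v ; fE = λ e → e
               ; f-src = λ _ → _≡_.refl ; f-tgt = λ _ → _≡_.refl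
               ; f-lV = λ _ → _≡_.refl ; f-lE = λ _ → _≡_.refl }

  infixr 9 _∘H_
  _∘H_ : ∀ {A B C} → Hom B C → Hom A B → Hom A C
  _∘H_ {A} {B} {C} g f = record
    { fV = λ v → fV g (fV f v)
    ; fE = λ e → fE g (fE f e)
    ; f-src = λ e → Relation.Binary.PropositionalEquality.trans (cong (fV g) (f-src f e)) (f-src g (fE f e))
    ; f-tgt = λ e → Relation.Binary.PropositionalEquality.trans (cong (fV g) (f-tgt f e)) (f-tgt g (fE f e))
    ; f-lV = λ v → Relation.Binary.PropositionalEquality.trans (f-lV g (fV f v)) (f-lV f v)
    ; f-lE = λ e → Relation.Binary.PropositionalEquality.trans (f-lE g (fE f e)) (f-lE f e)
    }

  _≈H_ : ∀ {A B} → Hom A B → Hom A B → Set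
  f ≈H g = (∀ v → fV f v ≡ fV g v) × (∀ e → fE f e ≡ fE g e)

  Injective : ∀ {A B} → Hom A B → Set
  Injective f = (∀ v w → fV f v ≡ fV f w → v ≡ w) × (∀ e d → fE f e ≡ fE f d → e ≡ d)

  record Iso (G H : Graph) : Set where
    field
      to     : Hom G H
      from   : Hom H G
      from∘to : (from ∘H to) ≈H idH
      to∘from : (to ∘H from) ≈H idH

  IsPushout : ∀ {A B C P} → Hom A B → Hom A C → Hom B P → Hom C P → Set
  IsPushout {A} {B} {C} {P} a b c d =
    ((c ∘H a) ≈H (d ∘H b)) ×
    (∀ (X : Graph) (f : Hom B X) (g : Hom C X) → (f ∘H a) ≈H (g ∘H b) →
       Σ (Hom P X) λ u → ((u ∘H c) ≈H f) × ((u ∘H d) ≈H g) ×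
         (∀ (u' : Hom P X) → (u' ∘H c) ≈H f → (u' ∘H d) ≈H g → u' ≈H u))

  -- rules L <- K -> R; the inclusions are represented by injective morphisms
  record Rule : Set where
    field
      L K R : Graph
      l     : Hom K L
      r     : Hom K R
      l-inj : Injective l
      r-inj : Injective r

  open Rule

  record DirDer (ρ : Rule) (G H : Graph) : Set where
    field
      match     : Hom (L ρ) G
      match-inj : Injective match
      D         : Graph
      k         : Hom (K ρ) D
      comatch   : Hom (R ρ) H
      inG       : Hom D G
      inH       : Hom D H
      po₁       : IsPushout (l ρ) k match inG
      po₂       : IsPushout (r ρ) k comatch inH

  open DirDer

  -- node component of the track morphism in' ∘ in⁻¹ (as a relation;
  -- it is functional since in is injective): Track d v w  means
  -- the track of v is defined and equal to w
  TrackDer : ∀ {ρ G H} → DirDer ρ G H → Fin (V G) → Fin (V H) → Set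
  TrackDer d v w = Σ (Fin (V (D d))) λ x → (fV (inG d) x ≡ v) × (fV (inH d) x ≡ w)

  record GTSys : Set where
    field
      nR    : ℕ
      rules : Fin nR → Rule

  open GTSys

  Der : GTSys → Graph → Graph → Set
  Der T G H = Σ (Fin (nR T)) λ i → DirDer (rules T i) G H

  TrackD : ∀ {T G H} → Der T G H → Fin (V G) → Fin (V H) → Set
  TrackD (i , d) = TrackDer d

  data Der⁼ (T : GTSys) (G H : Graph) : Set where
    isoStep  : Iso G H → Der⁼ T G H
    ruleStep : Der T G H → Der⁼ T G H

  Track⁼ : ∀ {T G H} → Der⁼ T G H → Fin (V G) → Fin (V H) → Set
  Track⁼ (isoStep φ) v w = fV (Iso.to φ) v ≡ w
  Track⁼ (ruleStep d) v w = TrackD d v w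

  _⨾_ : ∀ {X Y Z : Set} → (X → Y → Set) → (Y → Z → Set) → X → Z → Set
  (P ⨾ Q) x z = ∃ λ y → P x y × Q y z

  record Language : Set₁ where
    field
      _∈L_     : Graph → Set
      iso-closed : ∀ {G H} → Iso G H → _∈L_ G → _∈L_ H

  open Language

  -- D̂: smallest language containing D closed under subgraphs
  -- (a subgraph up to isomorphism = source of an injective morphism;
  --  this also covers isomorphism closure)
  data Hat (𝒟 : Language) : Graph → Set where
    base : ∀ {G} → _∈L_ 𝒟 G → Hat 𝒟 G
    sub  : ∀ {G H} (f : Hom G H) → Injective f → Hat 𝒟 H → Hat 𝒟 G

  InImgV : ∀ {A B} → Hom A B → Fin (V B) → Set
  InImgV f v = ∃ λ x → fV f x ≡ v

  InImgE : ∀ {A B} → Hom A B → Fin (E B) → Set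
  InImgE f e = ∃ λ x → fE f x ≡ e

  module _ {T : GTSys} {G H₁ H₂ : Graph} where

    ParIndep : Der T G H₁ → Der T G H₂ → Set
    ParIndep (i , d₁) (j , d₂) =
      (∀ v → InImgV (match d₁) v → InImgV (match d₂) v →
         InImgV (match d₁ ∘H l (rules T i)) v × InImgV (match d₂ ∘H l (rules T j)) v) ×
      (∀ e → InImgE (match d₁) e → InImgE (match d₂) e →
         InImgE (match d₁ ∘H l (rules T i)) e × InImgE (match d₂ ∘H l (rules T j)) e)

    CriticalPair : Der T G H₁ → Der T G H₂ → Set
    CriticalPair (i , d₁) (j , d₂) =
      ¬ ParIndep (i , d₁) (j , d₂) ×
      (∀ v → InImgV (match d₁) v ⊎ InImgV (match d₂) v) ×
      (∀ e → InImgE (match d₁) e ⊎ InImgE (match d₂) e) ×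
      ((eq : rules T i ≡ rules T j) →
         ¬ (subst (λ X → Hom X G) (cong Rule.L eq) (match d₁) ≈H match d₂))

    PersistentNode : Der T G H₁ → Der T G H₂ → Fin (V G) → Set
    PersistentNode d₁ d₂ v = (∃ λ w → TrackD d₁ v w) × (∃ λ w → TrackD d₂ v w)

    StronglySubcommutative : Der T G H₁ → Der T G H₂ → Set
    StronglySubcommutative d₁ d₂ =
      Σ Graph λ M → Σ (Der⁼ T H₁ M) λ s₁ → Σ (Der⁼ T H₂ M) λ s₂ →
        ∀ v → PersistentNode d₁ d₂ v →
          ∃ λ w → (TrackD d₁ ⨾ Track⁼ s₁) v w × (TrackD d₂ ⨾ Track⁼ s₂) v w

  NonGarbageCP : (𝒟 : Language) (G : Graph) → Set
  NonGarbageCP 𝒟 G = Hat 𝒟 G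

  AllNonGarbageCPsSSC : (T : GTSys) → Language → Set
  AllNonGarbageCPsSSC T 𝒟 =
    ∀ {G H₁ H₂} (d₁ : Der T G H₁) (d₂ : Der T G H₂) →
      CriticalPair d₁ d₂ → NonGarbageCP 𝒟 G → StronglySubcommutative d₁ d₂

  SubcommutativeUpToGarbage : (T : GTSys) → Language → Set
  SubcommutativeUpToGarbage T 𝒟 =
    ∀ {G H₁ H₂} → _∈L_ 𝒟 G → Der T G H₁ → Der T G H₂ →
      Σ Graph λ M → Der⁼ T H₁ M × Der⁼ T H₂ M

-- If the two steps are parallelly independent, the local Church–Rosser theorem joins them. Otherwise (and unless
-- already H₁ ≅ H₂) restricting both steps to G′ = g₁(L₁) ∪ g₂(L₂) yields a critical pair; G′ is a subgraph of
-- G ∈ 𝒟, so this pair is non-garbage and hence strongly subcommutative, joined in some M′. Now G is G′ glued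
-- with a context C along a discrete boundary B. Every boundary node is incident to an edge outside both matches,
-- so it is persistent, and strong subcommutativity sends it to the same node of M′ along both joins. By the
-- embedding theorem both joins extend to G, and both end in the pushout M′ +_B C.

module Submission where

open import Data.Nat using (ℕ; zero; suc; _+_)
open import Data.Fin using (Fin; zero; suc; _↑ˡ_; _↑ʳ_; splitAt)
open import Data.Fin.Properties
  using ( _≟_; any?; all?; suc-injective; ↑ˡ-injective; ↑ʳ-injective
        ; splitAt-↑ˡ; splitAt-↑ʳ; splitAt⁻¹-↑ˡ; splitAt⁻¹-↑ʳ)
open import Data.Product using (Σ; ∃; _×_; _,_; proj₁; proj₂)
open import Data.Sum using (_⊎_; inj₁; inj₂; [_,_]′) renaming (map to ⊎-map)
open import Data.Empty using (⊥; ⊥-elim)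
open import Relation.Nullary using (¬_; Dec; yes; no)
open import Relation.Nullary.Decidable using (_×-dec_; _⊎-dec_; _→-dec_; ¬?; toSum; map′)
open import Function.Bundles using (_⇔_; mk⇔; Equivalence)
open import Relation.Binary.PropositionalEquality using (_≡_; _≢_; refl; sym; trans; cong; subst; module ≡-Reasoning)

open import Defs

module _ (S : Signature) where

  open Graph
  open Hom

  Gr : Set
  Gr = Graph S

  infix 4 _⇒_ _≈_ _≅_
  infixr 9 _∙_

  _⇒_ : Gr → Gr → Set
  A ⇒ B = Hom S A B

  _∙_ : ∀ {A B C} → B ⇒ C → A ⇒ B → A ⇒ C
  g ∙ f = _∘H_ S g f

  id⇒ : ∀ {A} → A ⇒ A
  id⇒ = idH S

  ImV : ∀ {A B} → A ⇒ B → Fin (V B) → Set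
  ImV = InImgV S

  ImE : ∀ {A B} → A ⇒ B → Fin (E B) → Set
  ImE = InImgE S

  ImE⇒ImV-src : ∀ {A B} (f : A ⇒ B) {e} → ImE f e → ImV f (src B e)
  ImE⇒ImV-src {A} {B} f (x , refl) = src A x , f-src f x

  ImE⇒ImV-tgt : ∀ {A B} (f : A ⇒ B) {e} → ImE f e → ImV f (tgt B e)
  ImE⇒ImV-tgt {A} {B} f (x , refl) = tgt A x , f-tgt f x

  imV? : ∀ {A B} (f : A ⇒ B) v → Dec (ImV f v)
  imV? f v = any? (λ x → fV f x ≟ v)

  imE? : ∀ {A B} (f : A ⇒ B) e → Dec (ImE f e)
  imE? f e = any? (λ x → fE f x ≟ e)

  -- Record counterparts of _≈H_, Injective, Iso and IsPushout from Defs, indexed by the underlying maps so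
  -- that Agda can infer the morphisms from the type of an equation.
  record MapsEq {nv mv ne me : ℕ} (fv gv : Fin nv → Fin mv) (fe ge : Fin ne → Fin me) : Set where
    constructor mk≈
    field
      ≈V : ∀ v → fv v ≡ gv v
      ≈E : ∀ e → fe e ≡ ge e
  open MapsEq

  _≈_ : ∀ {A B} → A ⇒ B → A ⇒ B → Set
  f ≈ g = MapsEq (fV f) (fV g) (fE f) (fE g)

  ≈⇒≈H : ∀ {nv mv ne me} {fv gv : Fin nv → Fin mv} {fe ge : Fin ne → Fin me} →
    MapsEq fv gv fe ge → (∀ v → fv v ≡ gv v) × (∀ e → fe e ≡ ge e)
  ≈⇒≈H (mk≈ p q) = p , q

  ≈H⇒≈ : ∀ {nv mv ne me} {fv gv : Fin nv → Fin mv} {fe ge : Fin ne → Fin me} →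
    (∀ v → fv v ≡ gv v) × (∀ e → fe e ≡ ge e) → MapsEq fv gv fe ge
  ≈H⇒≈ (p , q) = mk≈ p q

  ≡⇒≈ : ∀ {A B} {f g : A ⇒ B} → f ≡ g → f ≈ g
  ≡⇒≈ refl = mk≈ (λ _ → refl) (λ _ → refl)

  ≈-refl : ∀ {nv mv ne me} {fv : Fin nv → Fin mv} {fe : Fin ne → Fin me} → MapsEq fv fv fe fe
  ≈-refl = mk≈ (λ _ → refl) (λ _ → refl)

  ≈-sym : ∀ {nv mv ne me} {fv gv : Fin nv → Fin mv} {fe ge : Fin ne → Fin me} →
    MapsEq fv gv fe ge → MapsEq gv fv ge fe
  ≈-sym (mk≈ p q) = mk≈ (λ v → sym (p v)) (λ e → sym (q e))

  ≈-trans : ∀ {nv mv ne me} {fv gv hv : Fin nv → Fin mv} {fe ge he : Fin ne → Fin me} →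
    MapsEq fv gv fe ge → MapsEq gv hv ge he → MapsEq fv hv fe he
  ≈-trans (mk≈ p q) (mk≈ p′ q′) = mk≈ (λ v → trans (p v) (p′ v)) (λ e → trans (q e) (q′ e))

  ∙-congʳ : ∀ {A B kv ke} {gv gv′ : Fin (V B) → Fin kv} {ge ge′ : Fin (E B) → Fin ke} (f : A ⇒ B) →
    MapsEq gv gv′ ge ge′ →
    MapsEq (λ x → gv (fV f x)) (λ x → gv′ (fV f x)) (λ x → ge (fE f x)) (λ x → ge′ (fE f x))
  ∙-congʳ f (mk≈ p q) = mk≈ (λ v → p (fV f v)) (λ e → q (fE f e))

  ∙-congˡ : ∀ {B C nv ne} (g : B ⇒ C) {fv fv′ : Fin nv → Fin (V B)} {fe fe′ : Fin ne → Fin (E B)} →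
    MapsEq fv fv′ fe fe′ →
    MapsEq (λ x → fV g (fv x)) (λ x → fV g (fv′ x)) (λ x → fE g (fe x)) (λ x → fE g (fe′ x))
  ∙-congˡ g (mk≈ p q) = mk≈ (λ v → cong (fV g) (p v)) (λ e → cong (fE g) (q e))

  record MapsInjective {nv mv ne me : ℕ} (fv : Fin nv → Fin mv) (fe : Fin ne → Fin me) : Set where
    constructor mkInj
    field
      injV : ∀ v w → fv v ≡ fv w → v ≡ w
      injE : ∀ e d → fe e ≡ fe d → e ≡ d
  open MapsInjective

  Inj : ∀ {A B} → A ⇒ B → Set
  Inj f = MapsInjective (fV f) (fE f)

  Inj⇒Injective : ∀ {nv mv ne me} {fv : Fin nv → Fin mv} {fe : Fin ne → Fin me} → MapsInjective fv fe →
    (∀ v w → fv v ≡ fv w → v ≡ w) × (∀ e d → fe e ≡ fe d → e ≡ d)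
  Inj⇒Injective (mkInj p q) = p , q

  Injective⇒Inj : ∀ {nv mv ne me} {fv : Fin nv → Fin mv} {fe : Fin ne → Fin me} →
    (∀ v w → fv v ≡ fv w → v ≡ w) × (∀ e d → fe e ≡ fe d → e ≡ d) → MapsInjective fv fe
  Injective⇒Inj (p , q) = mkInj p q

  ∙-injective : ∀ {a b c d e f} {gv : Fin b → Fin c} {ge : Fin e → Fin f} {fv : Fin a → Fin b} {fe : Fin d → Fin e} →
    MapsInjective gv ge → MapsInjective fv fe → MapsInjective (λ x → gv (fv x)) (λ x → ge (fe x))
  ∙-injective (mkInj gv ge) (mkInj fv fe) =
    mkInj (λ v w p → fv v w (gv _ _ p)) (λ v w p → fe v w (ge _ _ p))

  ∙-injectiveʳ : ∀ {A B C} (g : B ⇒ C) {f : A ⇒ B} → Inj (g ∙ f) → Inj f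
  ∙-injectiveʳ g (mkInj gv ge) = mkInj (λ v w p → gv v w (cong (fV g) p)) (λ v w p → ge v w (cong (fE g) p))

  Inj-resp-≈ : ∀ {nv mv ne me} {fv gv : Fin nv → Fin mv} {fe ge : Fin ne → Fin me} →
    MapsEq fv gv fe ge → MapsInjective fv fe → MapsInjective gv ge
  Inj-resp-≈ (mk≈ p q) (mkInj fv fe) =
    mkInj (λ v w r → fv v w (trans (p v) (trans r (sym (p w)))))
          (λ v w r → fe v w (trans (q v) (trans r (sym (q w)))))

  record _≅_ (A B : Gr) : Set where
    field
      to   : A ⇒ B
      from : B ⇒ A
      from∘to : from ∙ to ≈ id⇒
      to∘from : to ∙ from ≈ id⇒
  open _≅_

  ≅⇒Iso : ∀ {A B} → A ≅ B → Iso S A B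
  ≅⇒Iso φ = record { to = to φ ; from = from φ ; from∘to = ≈⇒≈H (from∘to φ) ; to∘from = ≈⇒≈H (to∘from φ) }

  Iso⇒≅ : ∀ {A B} → Iso S A B → A ≅ B
  Iso⇒≅ φ = record { to = Iso.to φ ; from = Iso.from φ
                   ; from∘to = ≈H⇒≈ (Iso.from∘to φ) ; to∘from = ≈H⇒≈ (Iso.to∘from φ) }

  ≅-injective : ∀ {A B} (φ : A ≅ B) → Inj (to φ)
  ≅-injective φ = ∙-injectiveʳ (from φ) {f = to φ} (Inj-resp-≈ (≈-sym (from∘to φ)) (mkInj (λ _ _ p → p) (λ _ _ p → p)))

  ≅-refl : ∀ {A} → A ≅ A
  ≅-refl = record { to = id⇒ ; from = id⇒ ; from∘to = ≈-refl ; to∘from = ≈-refl }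

  ≅-sym : ∀ {A B} → A ≅ B → B ≅ A
  ≅-sym φ = record { to = from φ ; from = to φ ; from∘to = to∘from φ ; to∘from = from∘to φ }

  ≅-trans : ∀ {A B C} → A ≅ B → B ≅ C → A ≅ C
  ≅-trans φ ψ = record
    { to = to ψ ∙ to φ ; from = from φ ∙ from ψ
    ; from∘to = mk≈ (λ v → trans (cong (fV (from φ)) (≈V (from∘to ψ) (fV (to φ) v))) (≈V (from∘to φ) v))
                    (λ e → trans (cong (fE (from φ)) (≈E (from∘to ψ) (fE (to φ) e))) (≈E (from∘to φ) e))
    ; to∘from = mk≈ (λ v → trans (cong (fV (to ψ)) (≈V (to∘from φ) (fV (from ψ) v))) (≈V (to∘from ψ) v))
                    (λ e → trans (cong (fE (to ψ)) (≈E (to∘from φ) (fE (from ψ) e))) (≈E (to∘from ψ) e)) }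

  -- Pushouts

  record IsPO {A B C P} (a : A ⇒ B) (b : A ⇒ C) (c : B ⇒ P) (d : C ⇒ P) : Set₁ where
    field
      comm : c ∙ a ≈ d ∙ b
      univ : ∀ (X : Gr) (f : B ⇒ X) (g : C ⇒ X) → f ∙ a ≈ g ∙ b →
        Σ (P ⇒ X) λ u → (u ∙ c ≈ f) × (u ∙ d ≈ g) × (∀ u′ → u′ ∙ c ≈ f → u′ ∙ d ≈ g → u′ ≈ u)
  open IsPO

  IsPO⇒IsPushout : ∀ {A B C P} {a : A ⇒ B} {b : A ⇒ C} {c : B ⇒ P} {d : C ⇒ P} →
    IsPO a b c d → IsPushout S a b c d
  IsPO⇒IsPushout po = ≈⇒≈H (comm po) , λ X f g h →
    let (u , uc , ud , uu) = univ po X f g (≈H⇒≈ h)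
    in u , ≈⇒≈H uc , ≈⇒≈H ud , λ u′ p q → ≈⇒≈H (uu u′ (≈H⇒≈ p) (≈H⇒≈ q))

  IsPushout⇒IsPO : ∀ {A B C P} {a : A ⇒ B} {b : A ⇒ C} {c : B ⇒ P} {d : C ⇒ P} →
    IsPushout S a b c d → IsPO a b c d
  IsPushout⇒IsPO (cm , un) = record
    { comm = ≈H⇒≈ cm
    ; univ = λ X f g h → let (u , p , q , r) = un X f g (≈⇒≈H h)
                         in u , ≈H⇒≈ p , ≈H⇒≈ q , λ u′ x y → ≈H⇒≈ (r u′ (≈⇒≈H x) (≈⇒≈H y)) }

  po-resp-≈ : ∀ {A B C P} {a a′ : A ⇒ B} {b b′ : A ⇒ C} {c c′ : B ⇒ P} {d d′ : C ⇒ P} →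
    a ≈ a′ → b ≈ b′ → c ≈ c′ → d ≈ d′ → IsPO a b c d → IsPO a′ b′ c′ d′
  po-resp-≈ {a = a} {a′} {b} {b′} {c} {c′} {d} {d′} ea eb ec ed po = record
    { comm = ≈-trans (≈-trans (∙-congʳ a′ (≈-sym ec)) (∙-congˡ c (≈-sym ea)))
                     (≈-trans (comm po) (≈-trans (∙-congʳ b ed) (∙-congˡ d′ eb)))
    ; univ = λ X f g h →
        let (u , uc , ud , uu) = univ po X f g (≈-trans (∙-congˡ f ea) (≈-trans h (∙-congˡ g (≈-sym eb))))
        in u , ≈-trans (∙-congˡ u (≈-sym ec)) uc , ≈-trans (∙-congˡ u (≈-sym ed)) ud ,
           λ u′ p q → uu u′ (≈-trans (∙-congˡ u′ ec) p) (≈-trans (∙-congˡ u′ ed) q) }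

  po-resp₁ : ∀ {A B C P} {a a′ : A ⇒ B} {b : A ⇒ C} {c : B ⇒ P} {d : C ⇒ P} →
    a ≈ a′ → IsPO a b c d → IsPO a′ b c d
  po-resp₁ ea = po-resp-≈ ea ≈-refl ≈-refl ≈-refl

  po-resp₂ : ∀ {A B C P} {a : A ⇒ B} {b b′ : A ⇒ C} {c : B ⇒ P} {d : C ⇒ P} →
    b ≈ b′ → IsPO a b c d → IsPO a b′ c d
  po-resp₂ eb = po-resp-≈ ≈-refl eb ≈-refl ≈-refl

  po-sym : ∀ {A B C P} {a : A ⇒ B} {b : A ⇒ C} {c : B ⇒ P} {d : C ⇒ P} → IsPO a b c d → IsPO b a d c
  po-sym po = record
    { comm = ≈-sym (comm po)
    ; univ = λ X f g h → let (u , p , q , r) = univ po X g f (≈-sym h) in u , q , p , λ u′ x y → r u′ y x }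

  po-ext : ∀ {A B C P X} {a : A ⇒ B} {b : A ⇒ C} {c : B ⇒ P} {d : C ⇒ P} →
    IsPO a b c d → (u u′ : P ⇒ X) → u ∙ c ≈ u′ ∙ c → u ∙ d ≈ u′ ∙ d → u ≈ u′
  po-ext {X = X} {c = c} {d} po u u′ p q =
    let (_ , _ , _ , unique) = univ po X (u′ ∙ c) (u′ ∙ d) (∙-congˡ u′ (comm po))
    in ≈-trans (unique u p q) (≈-sym (unique u′ ≈-refl ≈-refl))

  po-unique : ∀ {A B C P P′} {a : A ⇒ B} {b : A ⇒ C} {c : B ⇒ P} {d : C ⇒ P} {c′ : B ⇒ P′} {d′ : C ⇒ P′} →
    IsPO a b c d → IsPO a b c′ d′ → Σ (P ≅ P′) λ φ → (_≅_.to φ ∙ c ≈ c′) × (_≅_.to φ ∙ d ≈ d′)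
  po-unique {P = P} {P′} {c = c} {d} {c′} {d′} po po′ =
    let (u , uc , ud , _) = univ po P′ c′ d′ (comm po′)
        (v , vc , vd , _) = univ po′ P c d (comm po)
    in record { to = u ; from = v
              ; from∘to = po-ext po (v ∙ u) id⇒ (≈-trans (∙-congˡ v uc) vc) (≈-trans (∙-congˡ v ud) vd)
              ; to∘from = po-ext po′ (u ∙ v) id⇒ (≈-trans (∙-congˡ u vc) uc) (≈-trans (∙-congˡ u vd) ud) }
       , uc , ud

  po-reindex-apex : ∀ {A B C P P′} {a : A ⇒ B} {b : A ⇒ C} {c : B ⇒ P} {d : C ⇒ P} →
    IsPO a b c d → (φ : P ≅ P′) → IsPO a b (_≅_.to φ ∙ c) (_≅_.to φ ∙ d)
  po-reindex-apex {c = c} {d} po φ = record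
    { comm = ∙-congˡ (to φ) (comm po)
    ; univ = λ X f g h →
        let (u , uc , ud , uu) = univ po X f g h
        in u ∙ from φ , ≈-trans (∙-congˡ u (∙-congʳ c (from∘to φ))) uc ,
           ≈-trans (∙-congˡ u (∙-congʳ d (from∘to φ))) ud ,
           λ u′ p q → ≈-trans (∙-congˡ u′ (≈-sym (to∘from φ))) (∙-congʳ (from φ) (uu (u′ ∙ to φ) p q)) }

  po-reindex-C : ∀ {A B C C′ P} {a : A ⇒ B} {b : A ⇒ C} {c : B ⇒ P} {d : C ⇒ P} →
    IsPO a b c d → (ψ : C ≅ C′) → IsPO a (_≅_.to ψ ∙ b) c (d ∙ _≅_.from ψ)
  po-reindex-C {b = b} {c} {d} po ψ = record
    { comm = ≈-trans (comm po) (∙-congʳ b (≈-sym (∙-congˡ d (from∘to ψ))))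
    ; univ = λ X f g h →
        let (u , uc , ud , uu) = univ po X f (g ∙ to ψ) h
        in u , uc , ≈-trans (∙-congʳ (from ψ) ud) (∙-congˡ g (to∘from ψ)) ,
           λ u′ p q → uu u′ p (≈-trans (∙-congˡ u′ (∙-congˡ d (≈-sym (from∘to ψ)))) (∙-congʳ (to ψ) q)) }

  po-reindex-B : ∀ {A B B′ C P} {a : A ⇒ B} {b : A ⇒ C} {c : B ⇒ P} {d : C ⇒ P} →
    IsPO a b c d → (ψ : B ≅ B′) → IsPO (_≅_.to ψ ∙ a) b (c ∙ _≅_.from ψ) d
  po-reindex-B po ψ = po-sym (po-reindex-C (po-sym po) ψ)

  po-pasting : ∀ {A B C P C′ Q} {a : A ⇒ B} {b : A ⇒ C} {c : B ⇒ P} {d : C ⇒ P}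
    {b′ : C ⇒ C′} {c′ : P ⇒ Q} {d′ : C′ ⇒ Q} →
    IsPO a b c d → IsPO d b′ c′ d′ → IsPO a (b′ ∙ b) (c′ ∙ c) d′
  po-pasting {a = a} {b} {c} {d} {b′} {c′} {d′} po po′ = record
    { comm = ≈-trans (∙-congˡ c′ (comm po)) (∙-congʳ b (comm po′))
    ; univ = λ X f g h →
        let (u , uc , ud , uu) = univ po X f (g ∙ b′) h
            (w , wc , wd , wu) = univ po′ X u g ud
        in w , ≈-trans (∙-congʳ c wc) uc , wd ,
           λ w′ p q → wu w′ (uu (w′ ∙ c′) p (≈-trans (∙-congˡ w′ (comm po′)) (∙-congʳ b′ q))) q }

  po-pasting⁻¹ : ∀ {A B C D G₁ G} {f : A ⇒ B} {γ : A ⇒ C} {eD : B ⇒ D} {cD : C ⇒ D}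
    {h : B ⇒ G₁} {e : G₁ ⇒ G} {c : C ⇒ G} (q : D ⇒ G) →
    IsPO f γ eD cD → IsPO (h ∙ f) γ e c → q ∙ eD ≈ e ∙ h → q ∙ cD ≈ c → IsPO h eD e q
  po-pasting⁻¹ {f = f} {γ} {eD} {cD} {h} {e} {c} q left outer qe qc = record
    { comm = ≈-sym qe
    ; univ = λ X f₁ f₂ f₁h≈f₂eD →
        let (u , ue , uc , uu) = univ outer X f₁ (f₂ ∙ cD) (≈-trans (∙-congʳ f f₁h≈f₂eD) (∙-congˡ f₂ (comm left)))
        in u , ue ,
           po-ext left (u ∙ q) f₂ (≈-trans (∙-congˡ u qe) (≈-trans (∙-congʳ h ue) f₁h≈f₂eD))
                                  (≈-trans (∙-congˡ u qc) uc) ,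
           λ u′ p r → uu u′ p (≈-trans (∙-congˡ u′ (≈-sym qc)) (∙-congʳ cD r)) }

  -- Finite subgraphs

  record Enumeration (n : ℕ) (P : Fin n → Set) : Set where
    field
      size    : ℕ
      emb     : Fin size → Fin n
      emb-P   : ∀ i → P (emb i)
      emb-inj : ∀ i j → emb i ≡ emb j → i ≡ j
      idx     : ∀ x → P x → Fin size
      emb-idx : ∀ x (p : P x) → emb (idx x p) ≡ x
  open Enumeration

  enumerate : ∀ {n} (P : Fin n → Set) → (∀ x → Dec (P x)) → Enumeration n P
  enumerate {zero} P P? = record
    { size = 0 ; emb = λ () ; emb-P = λ () ; emb-inj = λ () ; idx = λ () ; emb-idx = λ () }
  enumerate {suc n} P P? with enumerate (λ x → P (suc x)) (λ x → P? (suc x)) | P? zero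
  ... | en | yes p0 = record
    { size = suc (size en) ; emb = em ; emb-P = em-P ; emb-inj = em-inj ; idx = ix ; emb-idx = em-ix }
    where
    em : Fin (suc (size en)) → Fin (suc n)
    em zero = zero
    em (suc i) = suc (emb en i)
    em-P : ∀ i → P (em i)
    em-P zero = p0
    em-P (suc i) = emb-P en i
    em-inj : ∀ i j → em i ≡ em j → i ≡ j
    em-inj zero zero _ = refl
    em-inj (suc i) (suc j) q = cong suc (emb-inj en i j (suc-injective q))
    ix : ∀ x → P x → Fin (suc (size en))
    ix zero _ = zero
    ix (suc x) p = suc (idx en x p)
    em-ix : ∀ x p → em (ix x p) ≡ x
    em-ix zero _ = refl
    em-ix (suc x) p = cong suc (emb-idx en x p)
  ... | en | no ¬p0 = record
    { size = size en ; emb = λ i → suc (emb en i) ; emb-P = emb-P en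
    ; emb-inj = λ i j q → emb-inj en i j (suc-injective q) ; idx = ix ; emb-idx = em-ix }
    where
    ix : ∀ x → P x → Fin (size en)
    ix zero p = ⊥-elim (¬p0 p)
    ix (suc x) p = idx en x p
    em-ix : ∀ x p → suc (emb en (ix x p)) ≡ x
    em-ix zero p = ⊥-elim (¬p0 p)
    em-ix (suc x) p = cong suc (emb-idx en x p)

  idx-irrelevant : ∀ {n P} (en : Enumeration n P) x (p p′ : P x) → idx en x p ≡ idx en x p′
  idx-irrelevant en x p p′ = emb-inj en _ _ (trans (emb-idx en x p) (sym (emb-idx en x p′)))

  idx-emb : ∀ {n P} (en : Enumeration n P) i (p : P (emb en i)) → idx en (emb en i) p ≡ i
  idx-emb en i p = emb-inj en _ _ (emb-idx en _ p)

  opaque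
    factorThrough : ∀ {A G X} (i : A ⇒ G) (f : X ⇒ G) → Inj i →
      (∀ x → ∃ λ a → fV i a ≡ fV f x) → (∀ e → ∃ λ a → fE i a ≡ fE f e) → Σ (X ⇒ A) λ h → i ∙ h ≈ f
    factorThrough {A} {G} {X} i f i-inj pv pe = h , mk≈ (λ x → proj₂ (pv x)) (λ e → proj₂ (pe e))
      where
      h : X ⇒ A
      h = record
        { fV = λ x → proj₁ (pv x)
        ; fE = λ e → proj₁ (pe e)
        ; f-src = λ e → injV i-inj _ _ (trans (proj₂ (pv _)) (trans (f-src f e)
                          (trans (cong (src G) (sym (proj₂ (pe e)))) (sym (f-src i _)))))
        ; f-tgt = λ e → injV i-inj _ _ (trans (proj₂ (pv _)) (trans (f-tgt f e)
                          (trans (cong (tgt G) (sym (proj₂ (pe e)))) (sym (f-tgt i _)))))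
        ; f-lV = λ x → trans (sym (f-lV i _)) (trans (cong (lV G) (proj₂ (pv x))) (f-lV f x))
        ; f-lE = λ x → trans (sym (f-lE i _)) (trans (cong (lE G) (proj₂ (pe x))) (f-lE f x)) }

  record Subgraph (G : Gr) (pV : Fin (V G) → Set) (pE : Fin (E G) → Set) : Set where
    field
      graph    : Gr
      incl     : graph ⇒ G
      incl-inj : Inj incl
      incl-PV  : ∀ v → pV (fV incl v)
      incl-PE  : ∀ e → pE (fE incl e)
      incl-ImV : ∀ v → pV v → ImV incl v
      incl-ImE : ∀ e → pE e → ImE incl e
  open Subgraph

  subgraph : (G : Gr) (pV : Fin (V G) → Set) (pE : Fin (E G) → Set) →
    (∀ v → Dec (pV v)) → (∀ e → Dec (pE e)) →
    (∀ e → pE e → pV (src G e)) → (∀ e → pE e → pV (tgt G e)) → Subgraph G pV pE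
  subgraph G pV pE pV? pE? src-closed tgt-closed = record
    { graph = H ; incl = i ; incl-inj = mkInj (emb-inj nv) (emb-inj ne)
    ; incl-PV = emb-P nv ; incl-PE = emb-P ne
    ; incl-ImV = λ v p → idx nv v p , emb-idx nv v p
    ; incl-ImE = λ e p → idx ne e p , emb-idx ne e p }
    where
    nv = enumerate pV pV?
    ne = enumerate pE pE?
    H : Gr
    H = record { V = size nv ; E = size ne
               ; src = λ e → idx nv (src G (emb ne e)) (src-closed _ (emb-P ne e))
               ; tgt = λ e → idx nv (tgt G (emb ne e)) (tgt-closed _ (emb-P ne e))
               ; lV = λ v → lV G (emb nv v) ; lE = λ e → lE G (emb ne e) }
    i : H ⇒ G
    i = record { fV = emb nv ; fE = emb ne
               ; f-src = λ e → emb-idx nv _ _ ; f-tgt = λ e → emb-idx nv _ _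
               ; f-lV = λ _ → refl ; f-lE = λ _ → refl }

  coverElim : ∀ {n a b} {i₁ : Fin a → Fin n} {i₂ : Fin b → Fin n} →
    (∀ v → (∃ λ x → i₁ x ≡ v) ⊎ (∃ λ y → i₂ y ≡ v)) →
    {P : Fin n → Set} → (∀ x → P (i₁ x)) → (∀ y → P (i₂ y)) → ∀ v → P v
  coverElim cover p₁ p₂ v = [ (λ { (x , refl) → p₁ x }) , (λ { (y , refl) → p₂ y }) ]′ (cover v)

  glueMaps : ∀ {a b c n : ℕ} {T : Set} (i₁ : Fin a → Fin n) (i₂ : Fin b → Fin n)
    (j₁ : Fin c → Fin a) (j₂ : Fin c → Fin b) →
    (∀ x y → i₁ x ≡ i₁ y → x ≡ y) → (∀ x y → i₂ x ≡ i₂ y → x ≡ y) →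
    (∀ v → (∃ λ x → i₁ x ≡ v) ⊎ (∃ λ y → i₂ y ≡ v)) →
    (∀ x y → i₁ x ≡ i₂ y → ∃ λ z → j₁ z ≡ x × j₂ z ≡ y) →
    (f : Fin a → T) (g : Fin b → T) → (∀ z → f (j₁ z) ≡ g (j₂ z)) →
    Σ (Fin n → T) λ u → (∀ x → u (i₁ x) ≡ f x) × (∀ y → u (i₂ y) ≡ g y) ×
      (∀ (u′ : Fin n → T) → (∀ x → u′ (i₁ x) ≡ f x) → (∀ y → u′ (i₂ y) ≡ g y) → ∀ v → u′ v ≡ u v)
  glueMaps {T = T} i₁ i₂ j₁ j₂ i₁-inj i₂-inj cover meet f g agree = u , on-i₁ , on-i₂ , unique
    where
    u : _ → T
    u v = [ (λ q → f (proj₁ q)) , (λ q → g (proj₁ q)) ]′ (cover v)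
    on-i₁ : ∀ x → u (i₁ x) ≡ f x
    on-i₁ x with cover (i₁ x)
    ... | inj₁ (x′ , q) = cong f (i₁-inj _ _ q)
    ... | inj₂ (y , q) = let (z , zx , zy) = meet x y (sym q) in
          trans (cong g (sym zy)) (trans (sym (agree z)) (cong f zx))
    on-i₂ : ∀ y → u (i₂ y) ≡ g y
    on-i₂ y with cover (i₂ y)
    ... | inj₂ (y′ , q) = cong g (i₂-inj _ _ q)
    ... | inj₁ (x , q) = let (z , zx , zy) = meet x y q in
          trans (cong f (sym zx)) (trans (agree z) (cong g zy))
    unique : ∀ u′ → (∀ x → u′ (i₁ x) ≡ f x) → (∀ y → u′ (i₂ y) ≡ g y) → ∀ v → u′ v ≡ u v
    unique u′ q₁ q₂ = coverElim cover (λ x → trans (q₁ x) (sym (on-i₁ x))) (λ y → trans (q₂ y) (sym (on-i₂ y)))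

  union-isPO : ∀ {S₁ S₂ S₁₂ G} (i₁ : S₁ ⇒ G) (i₂ : S₂ ⇒ G) (j₁ : S₁₂ ⇒ S₁) (j₂ : S₁₂ ⇒ S₂) →
    Inj i₁ → Inj i₂ → i₁ ∙ j₁ ≈ i₂ ∙ j₂ →
    (∀ v → ImV i₁ v ⊎ ImV i₂ v) → (∀ e → ImE i₁ e ⊎ ImE i₂ e) →
    (∀ x y → fV i₁ x ≡ fV i₂ y → ∃ λ z → fV j₁ z ≡ x × fV j₂ z ≡ y) →
    (∀ x y → fE i₁ x ≡ fE i₂ y → ∃ λ z → fE j₁ z ≡ x × fE j₂ z ≡ y) →
    IsPO j₁ j₂ i₁ i₂
  union-isPO {G = G} i₁ i₂ j₁ j₂ i₁-inj i₂-inj commutes coverV coverE meetV meetE =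
    record { comm = commutes ; univ = mediate }
    where
    mediate : ∀ X f g → f ∙ j₁ ≈ g ∙ j₂ →
      Σ (G ⇒ X) λ u → (u ∙ i₁ ≈ f) × (u ∙ i₂ ≈ g) ×
        (∀ u′ → u′ ∙ i₁ ≈ f → u′ ∙ i₂ ≈ g → u′ ≈ u)
    mediate X f g agree =
      u , mk≈ uv-i₁ ue-i₁ , mk≈ uv-i₂ ue-i₂ ,
      λ u′ p q → mk≈ (uv-unique (fV u′) (≈V p) (≈V q)) (ue-unique (fE u′) (≈E p) (≈E q))
      where
      gv = glueMaps (fV i₁) (fV i₂) (fV j₁) (fV j₂) (injV i₁-inj) (injV i₂-inj) coverV meetV (fV f) (fV g) (≈V agree)
      ge = glueMaps (fE i₁) (fE i₂) (fE j₁) (fE j₂) (injE i₁-inj) (injE i₂-inj) coverE meetE (fE f) (fE g) (≈E agree)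
      uv = proj₁ gv
      ue = proj₁ ge
      uv-i₁ = proj₁ (proj₂ gv)
      uv-i₂ = proj₁ (proj₂ (proj₂ gv))
      uv-unique = proj₂ (proj₂ (proj₂ gv))
      ue-i₁ = proj₁ (proj₂ ge)
      ue-i₂ = proj₁ (proj₂ (proj₂ ge))
      ue-unique = proj₂ (proj₂ (proj₂ ge))
      u : G ⇒ X
      u = record
        { fV = uv ; fE = ue
        ; f-src = coverElim coverE
            (λ x → trans (cong uv (sym (f-src i₁ x))) (trans (uv-i₁ _) (trans (f-src f x) (cong (src X) (sym (ue-i₁ x))))))
            (λ y → trans (cong uv (sym (f-src i₂ y))) (trans (uv-i₂ _) (trans (f-src g y) (cong (src X) (sym (ue-i₂ y))))))
        ; f-tgt = coverElim coverE
            (λ x → trans (cong uv (sym (f-tgt i₁ x))) (trans (uv-i₁ _) (trans (f-tgt f x) (cong (tgt X) (sym (ue-i₁ x))))))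
            (λ y → trans (cong uv (sym (f-tgt i₂ y))) (trans (uv-i₂ _) (trans (f-tgt g y) (cong (tgt X) (sym (ue-i₂ y))))))
        ; f-lV = coverElim coverV
            (λ x → trans (cong (lV X) (uv-i₁ x)) (trans (f-lV f x) (sym (f-lV i₁ x))))
            (λ y → trans (cong (lV X) (uv-i₂ y)) (trans (f-lV g y) (sym (f-lV i₂ y))))
        ; f-lE = coverElim coverE
            (λ x → trans (cong (lE X) (ue-i₁ x)) (trans (f-lE f x) (sym (f-lE i₁ x))))
            (λ y → trans (cong (lE X) (ue-i₂ y)) (trans (f-lE g y) (sym (f-lE i₂ y)))) }

  -- Pushouts along injective morphisms

  splitAt-elim : ∀ m {n} {P : Fin (m + n) → Set} → (∀ y → P (y ↑ˡ n)) → (∀ z → P (m ↑ʳ z)) → ∀ p → P p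
  splitAt-elim m {n} {P} left right p with splitAt m p in eq
  ... | inj₁ y = subst P (splitAt⁻¹-↑ˡ eq) (left y)
  ... | inj₂ z = subst P (splitAt⁻¹-↑ʳ eq) (right z)

  [_,_]+ : ∀ {m n} {T : Set} → (Fin m → T) → (Fin n → T) → Fin (m + n) → T
  [_,_]+ {m} f g p = [ f , g ]′ (splitAt m p)

  [,]+-↑ˡ : ∀ {m n} {T : Set} (f : Fin m → T) (g : Fin n → T) y → [ f , g ]+ (y ↑ˡ n) ≡ f y
  [,]+-↑ˡ {m} {n} f g y = cong [ f , g ]′ (splitAt-↑ˡ m y n)

  [,]+-↑ʳ : ∀ {m n} {T : Set} (f : Fin m → T) (g : Fin n → T) z → [ f , g ]+ (m ↑ʳ z) ≡ g z
  [,]+-↑ʳ {m} {n} f g z = cong [ f , g ]′ (splitAt-↑ʳ m n z)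

  ↑ˡ≢↑ʳ : ∀ {m n} (y : Fin m) (z : Fin n) → y ↑ˡ n ≢ m ↑ʳ z
  ↑ˡ≢↑ʳ {m} {n} y z q with trans (sym (splitAt-↑ˡ m y n)) (trans (cong (splitAt m) q) (splitAt-↑ʳ m n z))
  ... | ()

  imgElimV : ∀ {A B} (a : A ⇒ B) {P : Fin (V B) → Set} → (∀ w → P (fV a w)) → (∀ x → ¬ ImV a x → P x) → ∀ x → P x
  imgElimV a onImg offImg x with imV? a x
  ... | yes (w , refl) = onImg w
  ... | no ¬img = offImg x ¬img

  imgElimE : ∀ {A B} (a : A ⇒ B) {P : Fin (E B) → Set} → (∀ w → P (fE a w)) → (∀ x → ¬ ImE a x → P x) → ∀ x → P x
  imgElimE a onImg offImg x with imE? a x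
  ... | yes (w , refl) = onImg w
  ... | no ¬img = offImg x ¬img

  record PushoutFacts {A B C P} (a : A ⇒ B) (b : A ⇒ C) (c : B ⇒ P) (d : C ⇒ P) : Set where
    field
      d-inj    : Inj d
      coverV   : ∀ p → ImV d p ⊎ (∃ λ x → fV c x ≡ p × ¬ ImV a x)
      coverE   : ∀ p → ImE d p ⊎ (∃ λ x → fE c x ≡ p × ¬ ImE a x)
      overlapV : ∀ x y → fV c x ≡ fV d y → ImV a x
      overlapE : ∀ x y → fE c x ≡ fE d y → ImE a x
      c-inj    : Inj b → Inj c
  open PushoutFacts

  -- The pushout of an injective a : A ⇒ B along b : A ⇒ C is C plus the part of B outside a(A).
  module CanonicalPushout {A B C : Gr} (a : A ⇒ B) (b : A ⇒ C) (a-inj : Inj a) where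
    open ≡-Reasoning

    nB = enumerate (λ x → ¬ ImV a x) (λ x → ¬? (imV? a x))
    eB = enumerate (λ x → ¬ ImE a x) (λ x → ¬? (imE? a x))
    mV = size nB
    mE = size eB

    inlV : Fin (V C) → Fin (V C + mV)
    inlV y = y ↑ˡ mV
    inrV : Fin mV → Fin (V C + mV)
    inrV z = V C ↑ʳ z
    inlE : Fin (E C) → Fin (E C + mE)
    inlE y = y ↑ˡ mE
    inrE : Fin mE → Fin (E C + mE)
    inrE z = E C ↑ʳ z

    cV : Fin (V B) → Fin (V C + mV)
    cV x with imV? a x
    ... | yes (w , _) = inlV (fV b w)
    ... | no ¬img = inrV (idx nB x ¬img)

    cE : Fin (E B) → Fin (E C + mE)
    cE x with imE? a x
    ... | yes (w , _) = inlE (fE b w)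
    ... | no ¬img = inrE (idx eB x ¬img)

    cV-a : ∀ w → cV (fV a w) ≡ inlV (fV b w)
    cV-a w with imV? a (fV a w)
    ... | yes (w′ , q) = cong (λ t → inlV (fV b t)) (injV a-inj _ _ q)
    ... | no ¬img = ⊥-elim (¬img (w , refl))

    cE-a : ∀ w → cE (fE a w) ≡ inlE (fE b w)
    cE-a w with imE? a (fE a w)
    ... | yes (w′ , q) = cong (λ t → inlE (fE b t)) (injE a-inj _ _ q)
    ... | no ¬img = ⊥-elim (¬img (w , refl))

    cV-¬a : ∀ x (¬img : ¬ ImV a x) → cV x ≡ inrV (idx nB x ¬img)
    cV-¬a x ¬img with imV? a x
    ... | yes img = ⊥-elim (¬img img)
    ... | no ¬img′ = cong inrV (idx-irrelevant nB x ¬img′ ¬img)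

    cE-¬a : ∀ x (¬img : ¬ ImE a x) → cE x ≡ inrE (idx eB x ¬img)
    cE-¬a x ¬img with imE? a x
    ... | yes img = ⊥-elim (¬img img)
    ... | no ¬img′ = cong inrE (idx-irrelevant eB x ¬img′ ¬img)

    cV-emb : ∀ z → cV (emb nB z) ≡ inrV z
    cV-emb z = trans (cV-¬a _ (emb-P nB z)) (cong inrV (idx-emb nB z _))

    cE-emb : ∀ z → cE (emb eB z) ≡ inrE z
    cE-emb z = trans (cE-¬a _ (emb-P eB z)) (cong inrE (idx-emb eB z _))

    srcˡ = λ y → inlV (src C y)
    srcʳ = λ z → cV (src B (emb eB z))
    tgtˡ = λ y → inlV (tgt C y)
    tgtʳ = λ z → cV (tgt B (emb eB z))
    lVʳ = λ z → lV B (emb nB z)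
    lEʳ = λ z → lE B (emb eB z)

    Pg : Gr
    Pg = record
      { V = V C + mV ; E = E C + mE
      ; src = [ srcˡ , srcʳ ]+ ; tgt = [ tgtˡ , tgtʳ ]+
      ; lV = [ lV C , lVʳ ]+ ; lE = [ lE C , lEʳ ]+ }

    d : C ⇒ Pg
    d = record
      { fV = inlV ; fE = inlE
      ; f-src = λ y → sym ([,]+-↑ˡ _ _ y) ; f-tgt = λ y → sym ([,]+-↑ˡ _ _ y)
      ; f-lV = λ y → [,]+-↑ˡ _ _ y ; f-lE = λ y → [,]+-↑ˡ _ _ y }

    c : B ⇒ Pg
    c = record
      { fV = cV ; fE = cE
      ; f-src = imgElimE a (λ w → begin
            cV (src B (fE a w))         ≡⟨ cong cV (sym (f-src a w)) ⟩
            cV (fV a (src A w))         ≡⟨ cV-a _ ⟩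
            inlV (fV b (src A w))       ≡⟨ cong inlV (f-src b w) ⟩
            inlV (src C (fE b w))       ≡⟨ sym ([,]+-↑ˡ srcˡ srcʳ _) ⟩
            src Pg (inlE (fE b w))      ≡⟨ cong (src Pg) (sym (cE-a w)) ⟩
            src Pg (cE (fE a w))        ∎)
          (λ x ¬img → begin
            cV (src B x)                ≡⟨ cong (λ t → cV (src B t)) (sym (emb-idx eB x ¬img)) ⟩
            cV (src B (emb eB (idx eB x ¬img))) ≡⟨ sym ([,]+-↑ʳ srcˡ srcʳ _) ⟩
            src Pg (inrE (idx eB x ¬img))  ≡⟨ cong (src Pg) (sym (cE-¬a x ¬img)) ⟩
            src Pg (cE x)               ∎)
      ; f-tgt = imgElimE a (λ w → begin
            cV (tgt B (fE a w))         ≡⟨ cong cV (sym (f-tgt a w)) ⟩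
            cV (fV a (tgt A w))         ≡⟨ cV-a _ ⟩
            inlV (fV b (tgt A w))       ≡⟨ cong inlV (f-tgt b w) ⟩
            inlV (tgt C (fE b w))       ≡⟨ sym ([,]+-↑ˡ tgtˡ tgtʳ _) ⟩
            tgt Pg (inlE (fE b w))      ≡⟨ cong (tgt Pg) (sym (cE-a w)) ⟩
            tgt Pg (cE (fE a w))        ∎)
          (λ x ¬img → begin
            cV (tgt B x)                ≡⟨ cong (λ t → cV (tgt B t)) (sym (emb-idx eB x ¬img)) ⟩
            cV (tgt B (emb eB (idx eB x ¬img))) ≡⟨ sym ([,]+-↑ʳ tgtˡ tgtʳ _) ⟩
            tgt Pg (inrE (idx eB x ¬img))  ≡⟨ cong (tgt Pg) (sym (cE-¬a x ¬img)) ⟩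
            tgt Pg (cE x)               ∎)
      ; f-lV = imgElimV a
          (λ w → trans (cong (lV Pg) (cV-a w)) (trans ([,]+-↑ˡ (lV C) lVʳ _) (trans (f-lV b w) (sym (f-lV a w)))))
          (λ x ¬img → trans (cong (lV Pg) (cV-¬a x ¬img)) (trans ([,]+-↑ʳ (lV C) lVʳ _) (cong (lV B) (emb-idx nB x ¬img))))
      ; f-lE = imgElimE a
          (λ w → trans (cong (lE Pg) (cE-a w)) (trans ([,]+-↑ˡ (lE C) lEʳ _) (trans (f-lE b w) (sym (f-lE a w)))))
          (λ x ¬img → trans (cong (lE Pg) (cE-¬a x ¬img)) (trans ([,]+-↑ʳ (lE C) lEʳ _) (cong (lE B) (emb-idx eB x ¬img)))) }

    isPO : IsPO a b c d
    isPO = record { comm = mk≈ cV-a cE-a ; univ = mediate }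
      where
      mediate : ∀ X (f : B ⇒ X) (g : C ⇒ X) → f ∙ a ≈ g ∙ b →
        Σ (Pg ⇒ X) λ u → (u ∙ c ≈ f) × (u ∙ d ≈ g) × (∀ u′ → u′ ∙ c ≈ f → u′ ∙ d ≈ g → u′ ≈ u)
      mediate X f g agree = u , mk≈ u-cV u-cE , mk≈ ([,]+-↑ˡ uVˡ uVʳ) ([,]+-↑ˡ uEˡ uEʳ) , unique
        where
        uVˡ = fV g
        uVʳ = λ z → fV f (emb nB z)
        uEˡ = fE g
        uEʳ = λ z → fE f (emb eB z)
        uV = [ uVˡ , uVʳ ]+
        uE = [ uEˡ , uEʳ ]+
        u-cV : ∀ x → uV (cV x) ≡ fV f x
        u-cV = imgElimV a
          (λ w → trans (cong uV (cV-a w)) (trans ([,]+-↑ˡ uVˡ uVʳ _) (sym (≈V agree w))))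
          (λ x ¬img → trans (cong uV (cV-¬a x ¬img)) (trans ([,]+-↑ʳ uVˡ uVʳ _) (cong (fV f) (emb-idx nB x ¬img))))
        u-cE : ∀ x → uE (cE x) ≡ fE f x
        u-cE = imgElimE a
          (λ w → trans (cong uE (cE-a w)) (trans ([,]+-↑ˡ uEˡ uEʳ _) (sym (≈E agree w))))
          (λ x ¬img → trans (cong uE (cE-¬a x ¬img)) (trans ([,]+-↑ʳ uEˡ uEʳ _) (cong (fE f) (emb-idx eB x ¬img))))
        u : Pg ⇒ X
        u = record
          { fV = uV ; fE = uE
          ; f-src = splitAt-elim (E C)
              (λ y → trans (cong uV ([,]+-↑ˡ srcˡ srcʳ y)) (trans ([,]+-↑ˡ uVˡ uVʳ _)
                       (trans (f-src g y) (cong (src X) (sym ([,]+-↑ˡ uEˡ uEʳ y))))))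
              (λ z → trans (cong uV ([,]+-↑ʳ srcˡ srcʳ z)) (trans (u-cV _)
                       (trans (f-src f _) (cong (src X) (sym ([,]+-↑ʳ uEˡ uEʳ z))))))
          ; f-tgt = splitAt-elim (E C)
              (λ y → trans (cong uV ([,]+-↑ˡ tgtˡ tgtʳ y)) (trans ([,]+-↑ˡ uVˡ uVʳ _)
                       (trans (f-tgt g y) (cong (tgt X) (sym ([,]+-↑ˡ uEˡ uEʳ y))))))
              (λ z → trans (cong uV ([,]+-↑ʳ tgtˡ tgtʳ z)) (trans (u-cV _)
                       (trans (f-tgt f _) (cong (tgt X) (sym ([,]+-↑ʳ uEˡ uEʳ z))))))
          ; f-lV = splitAt-elim (V C)
              (λ y → trans (cong (lV X) ([,]+-↑ˡ uVˡ uVʳ y)) (trans (f-lV g y) (sym ([,]+-↑ˡ (lV C) lVʳ y))))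
              (λ z → trans (cong (lV X) ([,]+-↑ʳ uVˡ uVʳ z)) (trans (f-lV f _) (sym ([,]+-↑ʳ (lV C) lVʳ z))))
          ; f-lE = splitAt-elim (E C)
              (λ y → trans (cong (lE X) ([,]+-↑ˡ uEˡ uEʳ y)) (trans (f-lE g y) (sym ([,]+-↑ˡ (lE C) lEʳ y))))
              (λ z → trans (cong (lE X) ([,]+-↑ʳ uEˡ uEʳ z)) (trans (f-lE f _) (sym ([,]+-↑ʳ (lE C) lEʳ z)))) }
        unique : ∀ u′ → u′ ∙ c ≈ f → u′ ∙ d ≈ g → u′ ≈ u
        unique u′ p q = mk≈
          (splitAt-elim (V C) (λ y → trans (≈V q y) (sym ([,]+-↑ˡ uVˡ uVʳ y)))
                              (λ z → trans (cong (fV u′) (sym (cV-emb z))) (trans (≈V p _) (sym ([,]+-↑ʳ uVˡ uVʳ z)))))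
          (splitAt-elim (E C) (λ y → trans (≈E q y) (sym ([,]+-↑ˡ uEˡ uEʳ y)))
                              (λ z → trans (cong (fE u′) (sym (cE-emb z))) (trans (≈E p _) (sym ([,]+-↑ʳ uEˡ uEʳ z)))))

    c-injV : Inj b → ∀ x x′ → cV x ≡ cV x′ → x ≡ x′
    c-injV b-inj x x′ q with imV? a x | imV? a x′
    ... | yes (w , refl) | yes (w′ , refl) = cong (fV a) (injV b-inj _ _ (↑ˡ-injective mV _ _ q))
    ... | yes (w , refl) | no _ = ⊥-elim (↑ˡ≢↑ʳ _ _ q)
    ... | no _ | yes (w′ , refl) = ⊥-elim (↑ˡ≢↑ʳ _ _ (sym q))
    ... | no ¬i | no ¬i′ =
      trans (sym (emb-idx nB x ¬i)) (trans (cong (emb nB) (↑ʳ-injective (V C) _ _ q)) (emb-idx nB x′ ¬i′))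

    c-injE : Inj b → ∀ x x′ → cE x ≡ cE x′ → x ≡ x′
    c-injE b-inj x x′ q with imE? a x | imE? a x′
    ... | yes (w , refl) | yes (w′ , refl) = cong (fE a) (injE b-inj _ _ (↑ˡ-injective mE _ _ q))
    ... | yes (w , refl) | no _ = ⊥-elim (↑ˡ≢↑ʳ _ _ q)
    ... | no _ | yes (w′ , refl) = ⊥-elim (↑ˡ≢↑ʳ _ _ (sym q))
    ... | no ¬i | no ¬i′ =
      trans (sym (emb-idx eB x ¬i)) (trans (cong (emb eB) (↑ʳ-injective (E C) _ _ q)) (emb-idx eB x′ ¬i′))

    overlapV′ : ∀ x y → cV x ≡ inlV y → ImV a x
    overlapV′ x y q with imV? a x
    ... | yes img = img
    ... | no _ = ⊥-elim (↑ˡ≢↑ʳ y _ (sym q))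

    overlapE′ : ∀ x y → cE x ≡ inlE y → ImE a x
    overlapE′ x y q with imE? a x
    ... | yes img = img
    ... | no _ = ⊥-elim (↑ˡ≢↑ʳ y _ (sym q))

    facts : PushoutFacts a b c d
    facts = record
      { d-inj = mkInj (↑ˡ-injective mV) (↑ˡ-injective mE)
      ; coverV = splitAt-elim (V C) (λ y → inj₁ (y , refl)) (λ z → inj₂ (emb nB z , cV-emb z , emb-P nB z))
      ; coverE = splitAt-elim (E C) (λ y → inj₁ (y , refl)) (λ z → inj₂ (emb eB z , cE-emb z , emb-P eB z))
      ; overlapV = overlapV′
      ; overlapE = overlapE′
      ; c-inj = λ b-inj → mkInj (c-injV b-inj) (c-injE b-inj) }

  opaque
    canonicalPushout : ∀ {A B C : Gr} (a : A ⇒ B) (b : A ⇒ C) → Inj a →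
      Σ Gr λ P → Σ (B ⇒ P) λ c → Σ (C ⇒ P) λ d → IsPO a b c d × PushoutFacts a b c d
    canonicalPushout a b a-inj = Pg , c , d , isPO , facts
      where open CanonicalPushout a b a-inj

  -- Any pushout along an injective morphism is isomorphic to the canonical one and inherits its properties.
  pushoutFacts : ∀ {A B C P} {a : A ⇒ B} {b : A ⇒ C} {c : B ⇒ P} {d : C ⇒ P} →
    Inj a → IsPO a b c d → PushoutFacts a b c d
  pushoutFacts {a = a} {b} {c} {d} a-inj po = record
    { d-inj = Inj-resp-≈ ed (∙-injective (≅-injective φ) (d-inj F))
    ; coverV = λ p → ⊎-map (λ { (y , q) → y , trans (sym (≈V ed y)) (moveV q) })
                           (λ { (x , q , ¬img) → x , trans (sym (≈V ec x)) (moveV q) , ¬img })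
                           (coverV F (fV (from φ) p))
    ; coverE = λ p → ⊎-map (λ { (y , q) → y , trans (sym (≈E ed y)) (moveE q) })
                           (λ { (x , q , ¬img) → x , trans (sym (≈E ec x)) (moveE q) , ¬img })
                           (coverE F (fE (from φ) p))
    ; overlapV = λ x y q → overlapV F x y (injV (≅-injective φ) _ _ (trans (≈V ec x) (trans q (sym (≈V ed y)))))
    ; overlapE = λ x y q → overlapE F x y (injE (≅-injective φ) _ _ (trans (≈E ec x) (trans q (sym (≈E ed y)))))
    ; c-inj = λ b-inj → Inj-resp-≈ ec (∙-injective (≅-injective φ) (c-inj F b-inj)) }
    where
    canon = canonicalPushout a b a-inj
    F = proj₂ (proj₂ (proj₂ (proj₂ canon)))
    unique = po-unique (proj₁ (proj₂ (proj₂ (proj₂ canon)))) po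
    φ = proj₁ unique
    ec = proj₁ (proj₂ unique)
    ed = proj₂ (proj₂ unique)
    moveV : ∀ {p u} → u ≡ fV (from φ) p → fV (to φ) u ≡ p
    moveV {p} q = trans (cong (fV (to φ)) q) (≈V (to∘from φ) p)
    moveE : ∀ {p u} → u ≡ fE (from φ) p → fE (to φ) u ≡ p
    moveE {p} q = trans (cong (fE (to φ)) q) (≈E (to∘from φ) p)

  d-imageV : ∀ {A B C P} {a : A ⇒ B} {b : A ⇒ C} {c : B ⇒ P} {d : C ⇒ P} → PushoutFacts a b c d →
    ∀ p → (∀ x → fV c x ≡ p → ImV a x) → ImV d p
  d-imageV F p c⁻¹p⊆a = [ (λ img → img) , (λ { (x , q , ¬img) → ⊥-elim (¬img (c⁻¹p⊆a x q)) }) ]′ (coverV F p)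

  d-imageE : ∀ {A B C P} {a : A ⇒ B} {b : A ⇒ C} {c : B ⇒ P} {d : C ⇒ P} → PushoutFacts a b c d →
    ∀ p → (∀ x → fE c x ≡ p → ImE a x) → ImE d p
  d-imageE F p c⁻¹p⊆a = [ (λ img → img) , (λ { (x , q , ¬img) → ⊥-elim (¬img (c⁻¹p⊆a x q)) }) ]′ (coverE F p)

  -- Double-pushout derivations

  l-inj : (ρ : Rule S) → Inj (Rule.l ρ)
  l-inj ρ = Injective⇒Inj (Rule.l-inj ρ)

  r-inj : (ρ : Rule S) → Inj (Rule.r ρ)
  r-inj ρ = Injective⇒Inj (Rule.r-inj ρ)

  module _ {ρ : Rule S} {G H : Gr} (d : DirDer S ρ G H) where
    open DirDer d

    pushoutL : IsPO (Rule.l ρ) k match inG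
    pushoutL = IsPushout⇒IsPO po₁

    pushoutR : IsPO (Rule.r ρ) k comatch inH
    pushoutR = IsPushout⇒IsPO po₂

    match-Inj : Inj match
    match-Inj = Injective⇒Inj match-inj

    inG-Inj : Inj inG
    inG-Inj = d-inj (pushoutFacts (l-inj ρ) pushoutL)

    inH-Inj : Inj inH
    inH-Inj = d-inj (pushoutFacts (r-inj ρ) pushoutR)

    k-Inj : Inj k
    k-Inj = ∙-injectiveʳ inG {f = k} (Inj-resp-≈ (comm pushoutL) (∙-injective match-Inj (l-inj ρ)))

  open DirDer using (match; inG; inH; comatch)

  mkDirDer : ∀ {ρ : Rule S} {G H D : Gr} (g : Rule.L ρ ⇒ G) → Inj g → (k : Rule.K ρ ⇒ D) (h : Rule.R ρ ⇒ H)
    (i₁ : D ⇒ G) (i₂ : D ⇒ H) → IsPO (Rule.l ρ) k g i₁ → IsPO (Rule.r ρ) k h i₂ → DirDer S ρ G H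
  mkDirDer g g-inj k h i₁ i₂ p₁ p₂ = record
    { match = g ; match-inj = Inj⇒Injective g-inj ; D = _ ; k = k ; comatch = h
    ; inG = i₁ ; inH = i₂ ; po₁ = IsPO⇒IsPushout p₁ ; po₂ = IsPO⇒IsPushout p₂ }

  DirDer-resp-≅ˡ : ∀ {ρ G G′ H} → DirDer S ρ G H → G ≅ G′ → DirDer S ρ G′ H
  DirDer-resp-≅ˡ d φ = mkDirDer (to φ ∙ match d) (∙-injective (≅-injective φ) (match-Inj d)) (DirDer.k d)
    (comatch d) (to φ ∙ inG d) (inH d) (po-reindex-apex (pushoutL d) φ) (pushoutR d)

  DirDer-resp-≅ʳ : ∀ {ρ G H H′} → DirDer S ρ G H → H ≅ H′ → DirDer S ρ G H′
  DirDer-resp-≅ʳ d φ = mkDirDer (match d) (match-Inj d) (DirDer.k d) (to φ ∙ comatch d) (inG d) (to φ ∙ inH d)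
    (pushoutL d) (po-reindex-apex (pushoutR d) φ)

  DanglingCondition : ∀ {K L G} (g : L ⇒ G) (l : K ⇒ L) → Set
  DanglingCondition {G = G} g l =
    ∀ e → ImE g e ⊎ ((∀ x → fV g x ≡ src G e → ImV l x) × (∀ x → fV g x ≡ tgt G e → ImV l x))

  DirDer-dangling : ∀ {ρ G H} (d : DirDer S ρ G H) → DanglingCondition (match d) (Rule.l ρ)
  DirDer-dangling {ρ} {G} d e with coverE (pushoutFacts (l-inj ρ) (pushoutL d)) e
  ... | inj₂ (x , q , _) = inj₁ (x , q)
  ... | inj₁ (y , q) = inj₂ ( (λ x p → overlapV F x _ (trans p (trans (cong (src G) (sym q)) (sym (f-src (inG d) y)))))
                            , (λ x p → overlapV F x _ (trans p (trans (cong (tgt G) (sym q)) (sym (f-tgt (inG d) y))))))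
    where
    F = pushoutFacts (l-inj ρ) (pushoutL d)

  dangling-restrict : ∀ {K L G₁ G} {l : K ⇒ L} {g : L ⇒ G} (i : G₁ ⇒ G) (g₁ : L ⇒ G₁) → Inj i →
    i ∙ g₁ ≈ g → DanglingCondition g l → DanglingCondition g₁ l
  dangling-restrict i g₁ i-inj eq dangling e with dangling (fE i e)
  ... | inj₁ (y , q) = inj₁ (y , injE i-inj _ _ (trans (≈E eq y) q))
  ... | inj₂ (s , t) = inj₂ ( (λ x p → s x (trans (sym (≈V eq x)) (trans (cong (fV i) p) (f-src i e))))
                            , (λ x p → t x (trans (sym (≈V eq x)) (trans (cong (fV i) p) (f-tgt i e)))))

  record PushoutComplement {K L G} (l : K ⇒ L) (g : L ⇒ G) : Set₁ where
    field
      D  : Gr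
      k  : K ⇒ D
      i  : D ⇒ G
      po : IsPO l k g i

  -- D is G with g(L ∖ l(K)) removed, which is a subgraph thanks to the dangling condition.
  pushoutComplement : ∀ {K L G} (l : K ⇒ L) (g : L ⇒ G) → Inj g → DanglingCondition g l →
    PushoutComplement l g
  pushoutComplement {K} {L} {G} l g g-inj dangling =
    record { D = graph SD ; k = proj₁ k-fact ; i = incl SD ; po = po }
    where
    keptV : Fin (V G) → Set
    keptV v = ∀ x → fV g x ≡ v → ImV l x
    keptE : Fin (E G) → Set
    keptE e = ∀ x → fE g x ≡ e → ImE l x
    kept-src : ∀ e → keptE e → keptV (src G e)
    kept-src e kept = [ (λ { (x′ , q) x p → let (k′ , q′) = kept x′ q in
                             src K k′ , injV g-inj _ _ (trans (cong (fV g) (f-src l k′)) (trans (f-src g _)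
                               (trans (cong (λ t → src G (fE g t)) q′) (trans (cong (src G) q) (sym p))))) })
                      , proj₁ ]′ (dangling e)
    kept-tgt : ∀ e → keptE e → keptV (tgt G e)
    kept-tgt e kept = [ (λ { (x′ , q) x p → let (k′ , q′) = kept x′ q in
                             tgt K k′ , injV g-inj _ _ (trans (cong (fV g) (f-tgt l k′)) (trans (f-tgt g _)
                               (trans (cong (λ t → tgt G (fE g t)) q′) (trans (cong (tgt G) q) (sym p))))) })
                      , proj₂ ]′ (dangling e)
    SD = subgraph G keptV keptE
           (λ v → all? (λ x → (fV g x ≟ v) →-dec imV? l x)) (λ e → all? (λ x → (fE g x ≟ e) →-dec imE? l x))
           kept-src kept-tgt
    k-fact = factorThrough (incl SD) (g ∙ l) (incl-inj SD)
               (λ x → incl-ImV SD _ (λ x′ q → x , injV g-inj _ _ (sym q)))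
               (λ x → incl-ImE SD _ (λ x′ q → x , injE g-inj _ _ (sym q)))
    po : IsPO l (proj₁ k-fact) g (incl SD)
    po = union-isPO g (incl SD) l (proj₁ k-fact) g-inj (incl-inj SD) (≈-sym (proj₂ k-fact))
           (λ v → [ inj₁ , (λ ¬img → inj₂ (incl-ImV SD v (λ x q → ⊥-elim (¬img (x , q))))) ]′ (toSum (imV? g v)))
           (λ e → [ inj₁ , (λ ¬img → inj₂ (incl-ImE SD e (λ x q → ⊥-elim (¬img (x , q))))) ]′ (toSum (imE? g e)))
           (λ x y q → let (z , zq) = incl-PV SD y x q in
                      z , zq , injV (incl-inj SD) _ _ (trans (≈V (proj₂ k-fact) z) (trans (cong (fV g) zq) q)))
           (λ x y q → let (z , zq) = incl-PE SD y x q in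
                      z , zq , injE (incl-inj SD) _ _ (trans (≈E (proj₂ k-fact) z) (trans (cong (fE g) zq) q)))

  DirDer-exists : ∀ (ρ : Rule S) {G} (g : Rule.L ρ ⇒ G) → Inj g → DanglingCondition g (Rule.l ρ) →
    Σ Gr λ H → Σ (DirDer S ρ G H) λ d → match d ≡ g
  DirDer-exists ρ g g-inj dangling =
    _ , mkDirDer g g-inj (k PC) (proj₁ (proj₂ RO)) (i PC) (proj₁ (proj₂ (proj₂ RO))) (po PC)
                 (proj₁ (proj₂ (proj₂ (proj₂ RO)))) , refl
    where
    open PushoutComplement
    PC = pushoutComplement (Rule.l ρ) g g-inj dangling
    RO = canonicalPushout (Rule.r ρ) (k PC) (r-inj ρ)

  -- With a common match the two contexts D, D′ are isomorphic subgraphs of G, so the right-hand pushouts agree.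
  DirDer-unique : ∀ {ρ G H H′} (d : DirDer S ρ G H) (d′ : DirDer S ρ G H′) → match d ≈ match d′ → H ≅ H′
  DirDer-unique {ρ} d d′ same = proj₁ (po-unique pushoutR″ (pushoutR d′))
    where
    F = pushoutFacts (l-inj ρ) (pushoutL d)
    F′ = pushoutFacts (l-inj ρ) (pushoutL d′)
    fact = factorThrough (inG d′) (inG d) (d-inj F′)
       (λ y → d-imageV F′ _ λ x q → overlapV F x y (trans (≈V same x) q))
       (λ y → d-imageE F′ _ λ x q → overlapE F x y (trans (≈E same x) q))
    fact′ = factorThrough (inG d) (inG d′) (d-inj F)
       (λ y → d-imageV F _ λ x q → overlapV F′ x y (trans (sym (≈V same x)) q))
       (λ y → d-imageE F _ λ x q → overlapE F′ x y (trans (sym (≈E same x)) q))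
    ψ : DirDer.D d ≅ DirDer.D d′
    ψ = record
      { to = proj₁ fact ; from = proj₁ fact′
      ; from∘to = mk≈ (λ y → injV (d-inj F) _ _ (trans (≈V (proj₂ fact′) _) (≈V (proj₂ fact) y)))
                      (λ y → injE (d-inj F) _ _ (trans (≈E (proj₂ fact′) _) (≈E (proj₂ fact) y)))
      ; to∘from = mk≈ (λ y → injV (d-inj F′) _ _ (trans (≈V (proj₂ fact) _) (≈V (proj₂ fact′) y)))
                      (λ y → injE (d-inj F′) _ _ (trans (≈E (proj₂ fact) _) (≈E (proj₂ fact′) y))) }
    ψk : proj₁ fact ∙ DirDer.k d ≈ DirDer.k d′
    ψk = mk≈ (λ z → injV (d-inj F′) _ _ (trans (≈V (proj₂ fact) _) (trans (sym (≈V (comm (pushoutL d)) z))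
                      (trans (≈V same _) (≈V (comm (pushoutL d′)) z)))))
             (λ z → injE (d-inj F′) _ _ (trans (≈E (proj₂ fact) _) (trans (sym (≈E (comm (pushoutL d)) z))
                      (trans (≈E same _) (≈E (comm (pushoutL d′)) z)))))
    pushoutR″ : IsPO (Rule.r ρ) (DirDer.k d′) (comatch d) (inH d ∙ proj₁ fact′)
    pushoutR″ = po-resp₂ ψk (po-reindex-C (pushoutR d) ψ)

  -- Embedding

  record Embedding {B C H₁ : Gr} (ρ : Rule S) (G : Gr) (leg : B ⇒ H₁) (γ : B ⇒ C) : Set₁ where
    field
      H   : Gr
      der : DirDer S ρ G H
      eH  : H₁ ⇒ H
      cH  : C ⇒ H
      poH : IsPO leg γ eH cH

  -- Embedding theorem: a derivation G₁ ⇒ H₁ whose context D contains the boundary B extends along the gluing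
  -- G = G₁ +_B C to a derivation G ⇒ H with H = H₁ +_B C: glue D with C along B and paste the resulting
  -- pushout square onto each DPO square.
  embedDirDer : ∀ {ρ : Rule S} {G₁ H₁ B C G} (d : DirDer S ρ G₁ H₁) (β : B ⇒ DirDer.D d) (γ : B ⇒ C) → Inj γ →
    {e : G₁ ⇒ G} {c : C ⇒ G} → IsPO (inG d ∙ β) γ e c →
    Σ (Embedding ρ G (inH d ∙ β) γ) λ em → match (Embedding.der em) ≈ e ∙ match d
  embedDirDer {ρ} d β γ γ-inj {e} {c} outer =
    record { H = PH
           ; der = mkDirDer (e ∙ match d) (∙-injective (d-inj Fo) (match-Inj d)) (eD ∙ DirDer.k d) (eH ∙ comatch d)
                            q q′ (po-pasting (pushoutL d) right) (po-pasting (pushoutR d) right′)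
           ; eH = eH ; cH = cH ; poH = po-sym poHc } , ≈-refl
    where
    CD = canonicalPushout γ β γ-inj
    CH = canonicalPushout γ (inH d ∙ β) γ-inj
    PH = proj₁ CH
    cD = proj₁ (proj₂ CD)
    eD = proj₁ (proj₂ (proj₂ CD))
    cH = proj₁ (proj₂ CH)
    eH = proj₁ (proj₂ (proj₂ CH))
    poHc = proj₁ (proj₂ (proj₂ (proj₂ CH)))
    Fo = pushoutFacts γ-inj (po-sym outer)
    left : IsPO β γ eD cD
    left = po-sym (proj₁ (proj₂ (proj₂ (proj₂ CD))))
    u = IsPO.univ left _ (e ∙ inG d) c (comm outer)
    q = proj₁ u
    right : IsPO (inG d) eD e q
    right = po-pasting⁻¹ q left outer (proj₁ (proj₂ u)) (proj₁ (proj₂ (proj₂ u)))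
    u′ = IsPO.univ left PH (eH ∙ inH d) cH (comm (po-sym poHc))
    q′ = proj₁ u′
    right′ : IsPO (inH d) eD eH q′
    right′ = po-pasting⁻¹ q′ left (po-sym poHc) (proj₁ (proj₂ u′)) (proj₁ (proj₂ (proj₂ u′)))

  embed≅ : ∀ {B C H₁ M G} (leg : B ⇒ H₁) (γ : B ⇒ C) → Inj γ → (φ : H₁ ≅ M) →
    {e : H₁ ⇒ G} {c : C ⇒ G} → IsPO leg γ e c →
    Σ Gr λ G′ → G ≅ G′ × Σ (M ⇒ G′) λ e′ → Σ (C ⇒ G′) λ c′ → IsPO (to φ ∙ leg) γ e′ c′
  embed≅ leg γ γ-inj φ po =
    P , proj₁ (po-unique (po-reindex-B po φ) (po-sym poP)) , e′ , c′ , po-sym poP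
    where
    CN = canonicalPushout γ (to φ ∙ leg) γ-inj
    P = proj₁ CN
    c′ = proj₁ (proj₂ CN)
    e′ = proj₁ (proj₂ (proj₂ CN))
    poP = proj₁ (proj₂ (proj₂ (proj₂ CN)))

  -- Restriction to a subgraph

  -- G = G′ +_B C, where C consists of everything outside G′ together with the boundary nodes of G′ that an
  -- outside edge touches, and the boundary B is the discrete graph of those nodes.
  record Decomposition (G : Gr) (pE : Fin (E G) → Set) {G′ : Gr} (i : G′ ⇒ G) : Set₁ where
    field
      B C      : Gr
      j₁       : B ⇒ G′
      j₂       : B ⇒ C
      c        : C ⇒ G
      discrete : Fin (E B) → ⊥
      j₂-inj   : Inj j₂
      square   : IsPO j₁ j₂ i c
      boundary : ∀ b → ∃ λ e → ¬ pE e × (src G e ≡ fV (i ∙ j₁) b ⊎ tgt G e ≡ fV (i ∙ j₁) b)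

  decompose : ∀ {G pV pE} (SG : Subgraph G pV pE) → (∀ v → Dec (pV v)) → (∀ e → Dec (pE e)) →
    Decomposition G pE (incl SG)
  decompose {G} {pV} {pE} SG pV? pE? = record
    { B = graph SB ; C = graph SC ; j₁ = j₁ ; j₂ = j₂ ; c = incl SC
    ; discrete = incl-PE SB
    ; j₂-inj = ∙-injectiveʳ (incl SC) {f = j₂} (Inj-resp-≈ (≈-sym (proj₂ j₂-fact)) (incl-inj SB))
    ; square = union-isPO (incl SG) (incl SC) j₁ j₂ (incl-inj SG) (incl-inj SC)
        (≈-trans (proj₂ j₁-fact) (≈-sym (proj₂ j₂-fact)))
        (λ v → [ (λ p → inj₁ (incl-ImV SG v p)) , (λ ¬p → inj₂ (incl-ImV SC v (inj₁ ¬p))) ]′ (toSum (pV? v)))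
        (λ e → [ (λ p → inj₁ (incl-ImE SG e p)) , (λ ¬p → inj₂ (incl-ImE SC e ¬p)) ]′ (toSum (pE? e)))
        meetV
        (λ x y q → ⊥-elim (incl-PE SC y (subst pE q (incl-PE SG x))))
    ; boundary = λ b →
        let moved = λ {w} (p : w ≡ fV (incl SB) b) → trans p (sym (≈V (proj₂ j₁-fact) b))
        in [ (λ ¬p → ⊥-elim (¬p (proj₁ (incl-PV SB b))))
           , (λ { (e , ¬pe , touches) → e , ¬pe , ⊎-map moved moved touches }) ]′ (proj₂ (incl-PV SB b)) }
    where
    inContext : Fin (V G) → Set
    inContext v = ¬ pV v ⊎ (∃ λ e → ¬ pE e × (src G e ≡ v ⊎ tgt G e ≡ v))
    inContext? : ∀ v → Dec (inContext v)
    inContext? v = ¬? (pV? v) ⊎-dec any? (λ e → ¬? (pE? e) ×-dec ((src G e ≟ v) ⊎-dec (tgt G e ≟ v)))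
    SC = subgraph G inContext (λ e → ¬ pE e) inContext? (λ e → ¬? (pE? e))
           (λ e ¬p → inj₂ (e , ¬p , inj₁ refl)) (λ e ¬p → inj₂ (e , ¬p , inj₂ refl))
    SB = subgraph G (λ v → pV v × inContext v) (λ _ → ⊥)
           (λ v → pV? v ×-dec inContext? v) (λ _ → no (λ ())) (λ e ()) (λ e ())
    j₁-fact = factorThrough (incl SG) (incl SB) (incl-inj SG)
                (λ b → incl-ImV SG _ (proj₁ (incl-PV SB b))) (λ e → ⊥-elim (incl-PE SB e))
    j₂-fact = factorThrough (incl SC) (incl SB) (incl-inj SC)
                (λ b → incl-ImV SC _ (proj₂ (incl-PV SB b))) (λ e → ⊥-elim (incl-PE SB e))
    j₁ = proj₁ j₁-fact
    j₂ = proj₁ j₂-fact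
    meetV : ∀ x y → fV (incl SG) x ≡ fV (incl SC) y → ∃ λ z → fV j₁ z ≡ x × fV j₂ z ≡ y
    meetV x y q =
      let (z , zq) = incl-ImV SB (fV (incl SG) x) (incl-PV SG x , subst inContext (sym q) (incl-PV SC y))
      in z , injV (incl-inj SG) _ _ (trans (≈V (proj₂ j₁-fact) z) zq) ,
             injV (incl-inj SC) _ _ (trans (≈V (proj₂ j₂-fact) z) (trans zq q))

  imageUnion : ∀ {G L₁ L₂} (g₁ : L₁ ⇒ G) (g₂ : L₂ ⇒ G) →
    Subgraph G (λ v → ImV g₁ v ⊎ ImV g₂ v) (λ e → ImE g₁ e ⊎ ImE g₂ e)
  imageUnion {G} g₁ g₂ =
    subgraph G _ _ (λ v → imV? g₁ v ⊎-dec imV? g₂ v) (λ e → imE? g₁ e ⊎-dec imE? g₂ e)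
      (λ e → ⊎-map (ImE⇒ImV-src g₁) (ImE⇒ImV-src g₂)) (λ e → ⊎-map (ImE⇒ImV-tgt g₁) (ImE⇒ImV-tgt g₂))

  restrictDirDer : ∀ {ρ G G′ H} (i : G′ ⇒ G) → Inj i → (d : DirDer S ρ G H) →
    (∀ x → ImV i (fV (match d) x)) → (∀ x → ImE i (fE (match d) x)) →
    Σ Gr λ H′ → Σ (DirDer S ρ G′ H′) λ d′ → i ∙ match d′ ≈ match d
  restrictDirDer {ρ} i i-inj d inV inE =
    let (H′ , d′ , match≡) = DirDer-exists ρ g′ g′-inj
                               (dangling-restrict {l = Rule.l ρ} {g = match d} i g′ i-inj (proj₂ fact) (DirDer-dangling d))
    in H′ , d′ , ≈-trans (∙-congˡ i (≡⇒≈ match≡)) (proj₂ fact)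
    where
    fact = factorThrough i (match d) i-inj inV inE
    g′ = proj₁ fact
    g′-inj : Inj g′
    g′-inj = ∙-injectiveʳ i {f = g′} (Inj-resp-≈ (≈-sym (proj₂ fact)) (match-Inj d))

  -- The dangling condition of d puts such a node, if matched, in the interface.
  restrict-preserves : ∀ {ρ G G′ H H′} (i : G′ ⇒ G) (d : DirDer S ρ G H) (d′ : DirDer S ρ G′ H′) →
    i ∙ match d′ ≈ match d → ∀ v → (∃ λ e → ¬ ImE (match d) e × (src G e ≡ fV i v ⊎ tgt G e ≡ fV i v)) →
    ImV (inG d′) v
  restrict-preserves {ρ} i d d′ restricts v (e , ¬img , st) =
    d-imageV (pushoutFacts (l-inj ρ) (pushoutL d′)) v in-interface
    where
    in-interface : ∀ x → fV (match d′) x ≡ v → ImV (Rule.l ρ) x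
    in-interface x q with DirDer-dangling d e
    ... | inj₁ img = ⊥-elim (¬img img)
    ... | inj₂ (s , t) = [ (λ p → s x (trans (sym (≈V restricts x)) (trans (cong (fV i) q) (sym p))))
                         , (λ p → t x (trans (sym (≈V restricts x)) (trans (cong (fV i) q) (sym p)))) ]′ st

  -- Deciding isomorphism

  Extensional : ∀ {n m} → ((Fin n → Fin m) → Set) → Set
  Extensional P = ∀ f g → (∀ x → f x ≡ g x) → P f → P g

  ∃-fun? : ∀ {n m} (P : (Fin n → Fin m) → Set) → Extensional P → (∀ f → Dec (P f)) → Dec (∃ P)
  ∃-fun? {zero} P ext P? with P? (λ ())
  ... | yes p = yes (_ , p)
  ... | no ¬p = no (λ { (f , p) → ¬p (ext f _ (λ ()) p) })
  ∃-fun? {suc n} {m} P ext P? with any? (λ y → ∃-fun? (λ f → P (cons y f)) (ext-cons y) (λ f → P? (cons y f)))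
    where
    cons : Fin m → (Fin n → Fin m) → Fin (suc n) → Fin m
    cons y f zero = y
    cons y f (suc i) = f i
    ext-cons : ∀ y → Extensional (λ f → P (cons y f))
    ext-cons y f g f≗g = ext (cons y f) (cons y g) (λ { zero → refl ; (suc i) → f≗g i })
  ... | yes (y , f , p) = yes (_ , p)
  ... | no ¬p = no (λ { (f , p) → ¬p (f zero , (λ i → f (suc i)) , ext f _ (λ { zero → refl ; (suc i) → refl }) p) })

  HomMaps : (A B : Gr) → (Fin (V A) → Fin (V B)) → (Fin (E A) → Fin (E B)) → Set
  HomMaps A B fv fe = (∀ e → fv (src A e) ≡ src B (fe e)) × (∀ e → fv (tgt A e) ≡ tgt B (fe e))
                    × (∀ v → lV B (fv v) ≡ lV A v) × (∀ e → lE B (fe e) ≡ lE A e)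

  homMaps? : ∀ A B fv fe → Dec (HomMaps A B fv fe)
  homMaps? A B fv fe = all? (λ e → fv (src A e) ≟ src B (fe e)) ×-dec all? (λ e → fv (tgt A e) ≟ tgt B (fe e))
                ×-dec all? (λ v → lV B (fv v) ≟ lV A v) ×-dec all? (λ e → lE B (fe e) ≟ lE A e)

  HomMaps-resp : ∀ {A B fv fv′ fe fe′} → (∀ x → fv x ≡ fv′ x) → (∀ x → fe x ≡ fe′ x) →
    HomMaps A B fv fe → HomMaps A B fv′ fe′
  HomMaps-resp {A} {B} fv≗ fe≗ (s , t , lv , le) =
    (λ e → trans (sym (fv≗ _)) (trans (s e) (cong (src B) (fe≗ e)))) ,
    (λ e → trans (sym (fv≗ _)) (trans (t e) (cong (tgt B) (fe≗ e)))) ,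
    (λ v → trans (cong (lV B) (sym (fv≗ v))) (lv v)) ,
    (λ e → trans (cong (lE B) (sym (fe≗ e))) (le e))

  Inverses : ∀ {n m} → (Fin n → Fin m) → (Fin m → Fin n) → Set
  Inverses f g = (∀ x → g (f x) ≡ x) × (∀ y → f (g y) ≡ y)

  inverses? : ∀ {n m} (f : Fin n → Fin m) g → Dec (Inverses f g)
  inverses? f g = all? (λ x → g (f x) ≟ x) ×-dec all? (λ y → f (g y) ≟ y)

  Inverses-resp : ∀ {n m} {f f′ : Fin n → Fin m} {g g′} → (∀ x → f x ≡ f′ x) → (∀ y → g y ≡ g′ y) →
    Inverses f g → Inverses f′ g′
  Inverses-resp {f = f} {g = g} f≗ g≗ (gf , fg) =
    (λ x → trans (sym (g≗ _)) (trans (cong g (sym (f≗ x))) (gf x))) ,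
    (λ y → trans (sym (f≗ _)) (trans (cong f (sym (g≗ y))) (fg y)))

  IsoMaps : (A B : Gr) → (Fin (V A) → Fin (V B)) → (Fin (E A) → Fin (E B)) →
    (Fin (V B) → Fin (V A)) → (Fin (E B) → Fin (E A)) → Set
  IsoMaps A B fv fe gv ge = HomMaps A B fv fe × HomMaps B A gv ge × Inverses fv gv × Inverses fe ge

  IsoMaps-resp : ∀ {A B fv fv′ fe fe′ gv gv′ ge ge′} → (∀ x → fv x ≡ fv′ x) → (∀ x → fe x ≡ fe′ x) →
    (∀ x → gv x ≡ gv′ x) → (∀ x → ge x ≡ ge′ x) → IsoMaps A B fv fe gv ge → IsoMaps A B fv′ fe′ gv′ ge′
  IsoMaps-resp {A} {B} fv≗ fe≗ gv≗ ge≗ (f , g , v , e) =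
    HomMaps-resp {A} {B} fv≗ fe≗ f , HomMaps-resp {B} {A} gv≗ ge≗ g , Inverses-resp fv≗ gv≗ v , Inverses-resp fe≗ ge≗ e

  ≅⇔IsoMaps : ∀ {A B} → (A ≅ B) ⇔ (∃ λ fv → ∃ λ fe → ∃ λ gv → ∃ λ ge → IsoMaps A B fv fe gv ge)
  ≅⇔IsoMaps = mk⇔
    (λ φ → _ , _ , _ , _ ,
      (f-src (to φ) , f-tgt (to φ) , f-lV (to φ) , f-lE (to φ)) ,
      (f-src (from φ) , f-tgt (from φ) , f-lV (from φ) , f-lE (from φ)) ,
      (≈V (from∘to φ) , ≈V (to∘from φ)) , (≈E (from∘to φ) , ≈E (to∘from φ)))
    (λ { (fv , fe , gv , ge , (s , t , lv , le) , (s′ , t′ , lv′ , le′) , (gfV , fgV) , (gfE , fgE)) → record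
      { to = record { fV = fv ; fE = fe ; f-src = s ; f-tgt = t ; f-lV = lv ; f-lE = le }
      ; from = record { fV = gv ; fE = ge ; f-src = s′ ; f-tgt = t′ ; f-lV = lv′ ; f-lE = le′ }
      ; from∘to = mk≈ gfV gfE ; to∘from = mk≈ fgV fgE } })

  _≅?_ : (A B : Gr) → Dec (A ≅ B)
  A ≅? B = map′ (Equivalence.from ≅⇔IsoMaps) (Equivalence.to ≅⇔IsoMaps)
    (∃-fun? _ (λ _ _ eq (fe , gv , ge , iso) → fe , gv , ge , IsoMaps-resp eq (λ _ → refl) (λ _ → refl) (λ _ → refl) iso)
    λ fv → ∃-fun? _ (λ _ _ eq (gv , ge , iso) → gv , ge , IsoMaps-resp (λ _ → refl) eq (λ _ → refl) (λ _ → refl) iso)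
    λ fe → ∃-fun? _ (λ _ _ eq (ge , iso) → ge , IsoMaps-resp (λ _ → refl) (λ _ → refl) eq (λ _ → refl) iso)
    λ gv → ∃-fun? _ (λ _ _ eq iso → IsoMaps-resp (λ _ → refl) (λ _ → refl) (λ _ → refl) eq iso)
    λ ge → homMaps? A B fv fe ×-dec homMaps? B A gv ge ×-dec inverses? fv gv ×-dec inverses? fe ge)

  -- Joining two steps

  module _ {T : GTSys S} where

    rule : Fin (GTSys.nR T) → Rule S
    rule = GTSys.rules T

    Joinable : Gr → Gr → Set
    Joinable H₁ H₂ = Σ Gr λ M → Der⁼ S T H₁ M × Der⁼ S T H₂ M

    Der⁼-resp-≅ˡ : ∀ {X X′ Y} → X ≅ X′ → Der⁼ S T X′ Y → Der⁼ S T X Y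
    Der⁼-resp-≅ˡ φ (isoStep ψ) = isoStep (≅⇒Iso (≅-trans φ (Iso⇒≅ ψ)))
    Der⁼-resp-≅ˡ φ (ruleStep (k , d)) = ruleStep (k , DirDer-resp-≅ˡ d (≅-sym φ))

    Der⁼-resp-≅ʳ : ∀ {X Y Y′} → Der⁼ S T X Y → Y ≅ Y′ → Der⁼ S T X Y′
    Der⁼-resp-≅ʳ (isoStep ψ) φ = isoStep (≅⇒Iso (≅-trans (Iso⇒≅ ψ) φ))
    Der⁼-resp-≅ʳ (ruleStep (k , d)) φ = ruleStep (k , DirDer-resp-≅ʳ d φ)

    parIndep? : ∀ {G H₁ H₂} (d₁ : Der S T G H₁) (d₂ : Der S T G H₂) → Dec (ParIndep S d₁ d₂)
    parIndep? (i , d₁) (j , d₂) =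
      all? (λ v → imV? (match d₁) v →-dec imV? (match d₂) v →-dec
                  imV? (match d₁ ∙ Rule.l (rule i)) v ×-dec imV? (match d₂ ∙ Rule.l (rule j)) v)
      ×-dec
      all? (λ e → imE? (match d₁) e →-dec imE? (match d₂) e →-dec
                  imE? (match d₁ ∙ Rule.l (rule i)) e ×-dec imE? (match d₂ ∙ Rule.l (rule j)) e)

    -- Independence lets the second step restrict to the context D₁ of the first; embedding that restricted step
    -- into both sides of the first step's DPO diagram gives the two closing steps.
    localChurchRosser : ∀ {G H₁ H₂} i j (d₁ : DirDer S (rule i) G H₁) (d₂ : DirDer S (rule j) G H₂) →
      ParIndep S {T} (i , d₁) (j , d₂) → Joinable H₁ H₂
    localChurchRosser {G} {H₁} {H₂} i j d₁ d₂ (indV , indE) =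
      Embedding.H onH₁ , ruleStep (j , Embedding.der onH₁) , ruleStep (i , DirDer-resp-≅ˡ closing (≅-sym H₂≅))
      where
      ρ₁ = rule i
      ρ₂ = rule j
      F₁ = pushoutFacts (l-inj ρ₁) (pushoutL d₁)
      residual = restrictDirDer (inG d₁) (inG-Inj d₁) d₂
        (λ y → d-imageV F₁ _ λ x q → let (z , p) = proj₁ (indV _ (x , q) (y , refl))
                                     in z , injV (match-Inj d₁) _ _ (trans p (sym q)))
        (λ y → d-imageE F₁ _ λ x q → let (z , p) = proj₁ (indE _ (x , q) (y , refl))
                                     in z , injE (match-Inj d₁) _ _ (trans p (sym q)))
      dD = proj₁ (proj₂ residual)
      dD-match : inG d₁ ∙ match dD ≈ match d₂
      dD-match = proj₂ (proj₂ residual)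
      FD = pushoutFacts (l-inj ρ₂) (pushoutL dD)
      meetsV : ∀ z y → fV (match dD) y ≡ fV (DirDer.k d₁) z → fV (match d₁) (fV (Rule.l ρ₁) z) ≡ fV (match d₂) y
      meetsV z y q = trans (≈V (comm (pushoutL d₁)) z) (trans (cong (fV (inG d₁)) (sym q)) (≈V dD-match y))
      meetsE : ∀ z y → fE (match dD) y ≡ fE (DirDer.k d₁) z → fE (match d₁) (fE (Rule.l ρ₁) z) ≡ fE (match d₂) y
      meetsE z y q = trans (≈E (comm (pushoutL d₁)) z) (trans (cong (fE (inG d₁)) (sym q)) (≈E dD-match y))
      β-fact : Σ (Rule.K ρ₁ ⇒ DirDer.D dD) λ β → inG dD ∙ β ≈ DirDer.k d₁
      β-fact = factorThrough (inG dD) (DirDer.k d₁) (d-inj FD)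
        (λ z → d-imageV FD _ λ y q → let (w , p) = proj₂ (indV _ (_ , meetsV z y q) (y , refl))
                                     in w , injV (match-Inj d₂) _ _ p)
        (λ z → d-imageE FD _ λ y q → let (w , p) = proj₂ (indE _ (_ , meetsE z y q) (y , refl))
                                     in w , injE (match-Inj d₂) _ _ p)
      β = proj₁ β-fact
      β-inj : Inj β
      β-inj = ∙-injectiveʳ (inG dD) {f = β} (Inj-resp-≈ (≈-sym (proj₂ β-fact)) (k-Inj d₁))
      embG = embedDirDer dD β (Rule.l ρ₁) (l-inj ρ₁) (po-resp₁ (≈-sym (proj₂ β-fact)) (po-sym (pushoutL d₁)))
      onG = proj₁ embG
      onH₁ = proj₁ (embedDirDer dD β (Rule.r ρ₁) (r-inj ρ₁) (po-resp₁ (≈-sym (proj₂ β-fact)) (po-sym (pushoutR d₁))))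
      H₂≅ : H₂ ≅ Embedding.H onG
      H₂≅ = DirDer-unique d₂ (Embedding.der onG) (≈-sym (≈-trans (proj₂ embG) dD-match))
      closing : DirDer S ρ₁ (Embedding.H onG) (Embedding.H onH₁)
      closing = mkDirDer (Embedding.cH onG)
        (c-inj (pushoutFacts (l-inj ρ₁) (po-sym (Embedding.poH onG))) (∙-injective (inH-Inj dD) β-inj))
        (inH dD ∙ β) (Embedding.cH onH₁) (Embedding.eH onG) (Embedding.eH onH₁)
        (po-sym (Embedding.poH onG)) (po-sym (Embedding.poH onH₁))

    -- A step X ⇒⁼ Y with Y = Y′ +_B C, where B sits in Y′ through W.
    record EmbeddedStep (X Y′ : Gr) {B C : Gr} (γ : B ⇒ C) (W : Fin (V B) → Fin (V Y′)) : Set₁ where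
      field
        Y      : Gr
        step   : Der⁼ S T X Y
        leg    : B ⇒ Y′
        leg-W  : ∀ b → fV leg b ≡ W b
        inY    : Y′ ⇒ Y
        ctxY   : C ⇒ Y
        glue   : IsPO leg γ inY ctxY

    embedStep : ∀ {B C X X′ Y′} (s : Der⁼ S T X′ Y′) (leg : B ⇒ X′) (γ : B ⇒ C) → Inj γ →
      (Fin (E B) → ⊥) → {e : X′ ⇒ X} {c : C ⇒ X} → IsPO leg γ e c →
      (W : Fin (V B) → Fin (V Y′)) → (∀ b → Track⁼ S s (fV leg b) (W b)) → EmbeddedStep X Y′ γ W
    embedStep (isoStep φ) leg γ γ-inj _ po W tracks =
      let (Y , ψ , e′ , c′ , po′) = embed≅ leg γ γ-inj (Iso⇒≅ φ) po
      in record { Y = Y ; step = isoStep (≅⇒Iso ψ) ; leg = to (Iso⇒≅ φ) ∙ leg ; leg-W = tracks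
                ; inY = e′ ; ctxY = c′ ; glue = po′ }
    embedStep (ruleStep (k , ds)) leg γ γ-inj discrete po W tracks =
      record { Y = Embedding.H em ; step = ruleStep (k , Embedding.der em) ; leg = inH ds ∙ β ; leg-W = leg′-W
             ; inY = Embedding.eH em ; ctxY = Embedding.cH em ; glue = Embedding.poH em }
      where
      β-fact = factorThrough (inG ds) leg (inG-Inj ds) (λ b → let (x , p , _) = tracks b in x , p) (λ e → ⊥-elim (discrete e))
      β = proj₁ β-fact
      em = proj₁ (embedDirDer ds β γ γ-inj (po-resp₁ (≈-sym (proj₂ β-fact)) po))
      leg′-W : ∀ b → fV (inH ds) (fV β b) ≡ W b
      leg′-W b = let (x , p , q) = tracks b in
        trans (cong (fV (inH ds)) (injV (inG-Inj ds) _ _ (trans (≈V (proj₂ β-fact) b) (sym p)))) q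

    ParIndep-restrict : ∀ {G G′ H₁ H₂ H₁′ H₂′} (i : G′ ⇒ G) → Inj i → ∀ p q
      {d₁ : DirDer S (rule p) G H₁} {d₂ : DirDer S (rule q) G H₂}
      {d₁′ : DirDer S (rule p) G′ H₁′} {d₂′ : DirDer S (rule q) G′ H₂′} →
      i ∙ match d₁′ ≈ match d₁ → i ∙ match d₂′ ≈ match d₂ →
      ParIndep S {T} (p , d₁′) (q , d₂′) → ParIndep S {T} (p , d₁) (q , d₂)
    ParIndep-restrict i i-inj p q {d₁′ = d₁′} {d₂′} r₁ r₂ (indV , indE) = indV↑ , indE↑
      where
      indV↑ : ∀ v → _ → _ → _
      indV↑ v (x , qx) (y , qy) =
        let hit = injV i-inj _ _ (trans (≈V r₂ y) (trans qy (sym (trans (≈V r₁ x) qx))))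
            ((z , pz) , (z′ , pz′)) = indV (fV (match d₁′) x) (x , refl) (y , hit)
        in (z , trans (sym (≈V r₁ _)) (trans (cong (fV i) pz) (trans (≈V r₁ x) qx))) ,
           (z′ , trans (sym (≈V r₂ _)) (trans (cong (fV i) pz′) (trans (≈V r₁ x) qx)))
      indE↑ : ∀ e → _ → _ → _
      indE↑ e (x , qx) (y , qy) =
        let hit = injE i-inj _ _ (trans (≈E r₂ y) (trans qy (sym (trans (≈E r₁ x) qx))))
            ((z , pz) , (z′ , pz′)) = indE (fE (match d₁′) x) (x , refl) (y , hit)
        in (z , trans (sym (≈E r₁ _)) (trans (cong (fE i) pz) (trans (≈E r₁ x) qx))) ,
           (z′ , trans (sym (≈E r₂ _)) (trans (cong (fE i) pz′) (trans (≈E r₁ x) qx)))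

    sameRestrictedMatch⇒≅ : ∀ {ρ ρ′ : Rule S} (eq : ρ ≡ ρ′) {G G′ H H′} (i : G′ ⇒ G)
      (d : DirDer S ρ G H) (d′ : DirDer S ρ′ G H′) (g : Rule.L ρ ⇒ G′) (g′ : Rule.L ρ′ ⇒ G′) →
      i ∙ g ≈ match d → i ∙ g′ ≈ match d′ → _≈H_ S (subst (λ X → Hom S X G′) (cong Rule.L eq) g) g′ → H ≅ H′
    sameRestrictedMatch⇒≅ refl i d d′ g g′ r r′ g≈g′ =
      DirDer-unique d d′ (≈-trans (≈-sym r) (≈-trans (∙-congˡ i (≈H⇒≈ g≈g′)) r′))

    restriction-isCriticalPair : ∀ {G G′ H₁ H₂ H₁′ H₂′} (i : G′ ⇒ G) → Inj i → ∀ p q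
      {d₁ : DirDer S (rule p) G H₁} {d₂ : DirDer S (rule q) G H₂}
      {d₁′ : DirDer S (rule p) G′ H₁′} {d₂′ : DirDer S (rule q) G′ H₂′} →
      i ∙ match d₁′ ≈ match d₁ → i ∙ match d₂′ ≈ match d₂ →
      (∀ v → ImV (match d₁) (fV i v) ⊎ ImV (match d₂) (fV i v)) →
      (∀ e → ImE (match d₁) (fE i e) ⊎ ImE (match d₂) (fE i e)) →
      ¬ ParIndep S {T} (p , d₁) (q , d₂) → ¬ (H₁ ≅ H₂) → CriticalPair S {T} (p , d₁′) (q , d₂′)
    restriction-isCriticalPair i i-inj p q {d₁} {d₂} {d₁′} {d₂′} r₁ r₂ coverV coverE dependent H₁≇H₂ =
      (λ ind → dependent (ParIndep-restrict i i-inj p q {d₁} {d₂} {d₁′} {d₂′} r₁ r₂ ind)) ,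
      (λ v → ⊎-map (λ { (x , q) → x , injV i-inj _ _ (trans (≈V r₁ x) q) })
                   (λ { (x , q) → x , injV i-inj _ _ (trans (≈V r₂ x) q) }) (coverV v)) ,
      (λ e → ⊎-map (λ { (x , q) → x , injE i-inj _ _ (trans (≈E r₁ x) q) })
                   (λ { (x , q) → x , injE i-inj _ _ (trans (≈E r₂ x) q) }) (coverE e)) ,
      (λ eq same → H₁≇H₂ (sameRestrictedMatch⇒≅ eq i d₁ d₂ (match d₁′) (match d₂′) r₁ r₂ same))

    -- Transfers one leg of a join of the restricted pair to G = G′ +_B C, ending in M′ +_B C.
    embedJoinLeg : ∀ {ρ G G′ H H′ M′ B C} {i : G′ ⇒ G} {j₁ : B ⇒ G′} {j₂ : B ⇒ C} {c : C ⇒ G} →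
      IsPO j₁ j₂ i c → Inj j₂ → (Fin (E B) → ⊥) →
      (d : DirDer S ρ G H) (d′ : DirDer S ρ G′ H′) → i ∙ match d′ ≈ match d →
      (s : Der⁼ S T H′ M′) (W : Fin (V B) → Fin (V M′)) →
      (∀ b → ∃ λ y → TrackDer S d′ (fV j₁ b) y × Track⁼ S s y (W b)) → EmbeddedStep H M′ j₂ W
    embedJoinLeg {j₁ = j₁} {j₂} square j₂-inj discrete d d′ restricts s W tracks =
      record { EmbeddedStep embedded′ hiding (step) ; step = Der⁼-resp-≅ˡ H≅ (EmbeddedStep.step embedded′) }
      where
      β-fact = factorThrough (inG d′) j₁ (inG-Inj d′)
                 (λ b → let (_ , (x , p , _) , _) = tracks b in x , p) (λ e → ⊥-elim (discrete e))
      β = proj₁ β-fact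
      embedded = embedDirDer d′ β j₂ j₂-inj (po-resp₁ (≈-sym (proj₂ β-fact)) square)
      em = proj₁ embedded
      H≅ = DirDer-unique d (Embedding.der em) (≈-sym (≈-trans (proj₂ embedded) restricts))
      tracks′ : ∀ b → Track⁼ S s (fV (inH d′) (fV β b)) (W b)
      tracks′ b =
        let (_ , (x , p , q) , t) = tracks b
            x≡βb = injV (inG-Inj d′) _ _ (trans p (sym (≈V (proj₂ β-fact) b)))
        in subst (λ u → Track⁼ S s u (W b)) (trans (sym q) (cong (fV (inH d′)) x≡βb)) t
      embedded′ = embedStep s (inH d′ ∙ β) j₂ j₂-inj discrete (Embedding.poH em) W tracks′

    criticalPairCase : (𝒟 : Language S) → AllNonGarbageCPsSSC S T 𝒟 →
      ∀ {G H₁ H₂} i j (d₁ : DirDer S (rule i) G H₁) (d₂ : DirDer S (rule j) G H₂) →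
      Language._∈L_ 𝒟 G → ¬ ParIndep S {T} (i , d₁) (j , d₂) → ¬ (H₁ ≅ H₂) → Joinable H₁ H₂
    criticalPairCase 𝒟 allSSC {G} i j d₁ d₂ G∈𝒟 dependent H₁≇H₂ =
      Y leg₁ , step leg₁ , Der⁼-resp-≅ʳ (step leg₂) (proj₁ (po-unique (glue leg₂) (po-resp₁ legs≈ (glue leg₁))))
      where
      SG = imageUnion (match d₁) (match d₂)
      i₁ = incl SG
      open Decomposition (decompose SG (λ v → imV? (match d₁) v ⊎-dec imV? (match d₂) v)
                                       (λ e → imE? (match d₁) e ⊎-dec imE? (match d₂) e))
      open EmbeddedStep
      r₁ = restrictDirDer i₁ (incl-inj SG) d₁ (λ x → incl-ImV SG _ (inj₁ (x , refl)))
                                               (λ x → incl-ImE SG _ (inj₁ (x , refl)))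
      r₂ = restrictDirDer i₁ (incl-inj SG) d₂ (λ x → incl-ImV SG _ (inj₂ (x , refl)))
                                               (λ x → incl-ImE SG _ (inj₂ (x , refl)))
      d₁′ = proj₁ (proj₂ r₁)
      d₂′ = proj₁ (proj₂ r₂)
      rm₁ = proj₂ (proj₂ r₁)
      rm₂ = proj₂ (proj₂ r₂)
      critical : CriticalPair S {T} (i , d₁′) (j , d₂′)
      critical = restriction-isCriticalPair i₁ (incl-inj SG) i j {d₁} {d₂} {d₁′} {d₂′} rm₁ rm₂
                   (incl-PV SG) (incl-PE SG) dependent H₁≇H₂
      join = allSSC (i , d₁′) (j , d₂′) critical (sub i₁ (Inj⇒Injective (incl-inj SG)) (base G∈𝒟))
      s₁ = proj₁ (proj₂ join)
      s₂ = proj₁ (proj₂ (proj₂ join))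
      agree = proj₂ (proj₂ (proj₂ join))
      preserved : ∀ {ρ H H′} (d : DirDer S ρ G H) (d′ : DirDer S ρ (graph SG) H′) → i₁ ∙ match d′ ≈ match d →
        (∀ e → ImE (match d) e → ImE (match d₁) e ⊎ ImE (match d₂) e) → ∀ b → ∃ λ w → TrackDer S d′ (fV j₁ b) w
      preserved d d′ restricts ⊆inMatches b =
        let (e , outside , touches) = boundary b
            (x , p) = restrict-preserves i₁ d d′ restricts (fV j₁ b) (e , (λ img → outside (⊆inMatches e img)) , touches)
        in fV (inH d′) x , x , p , refl
      persistent : ∀ b → PersistentNode S (i , d₁′) (j , d₂′) (fV j₁ b)
      persistent b = preserved d₁ d₁′ rm₁ (λ _ → inj₁) b , preserved d₂ d₂′ rm₂ (λ _ → inj₂) b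
      W : Fin (V B) → Fin (V (proj₁ join))
      W b = proj₁ (agree _ (persistent b))
      leg₁ = embedJoinLeg square j₂-inj discrete d₁ d₁′ rm₁ s₁ W (λ b → proj₁ (proj₂ (agree _ (persistent b))))
      leg₂ = embedJoinLeg square j₂-inj discrete d₂ d₂′ rm₂ s₂ W (λ b → proj₂ (proj₂ (agree _ (persistent b))))
      legs≈ : leg leg₁ ≈ leg leg₂
      legs≈ = mk≈ (λ b → trans (leg-W leg₁ b) (sym (leg-W leg₂ b))) (λ e → ⊥-elim (discrete e))

mainTheorem14 : (S : Signature) (T : GTSys S) (𝒟 : Language S) →
                AllNonGarbageCPsSSC S T 𝒟 → SubcommutativeUpToGarbage S T 𝒟
mainTheorem14 S T 𝒟 allSSC {_} {H₁} {H₂} G∈𝒟 (i , d₁) (j , d₂) with parIndep? S (i , d₁) (j , d₂)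
... | yes independent = localChurchRosser S i j d₁ d₂ independent
-- Equality of rules is undecidable, so rather than asking whether both steps use the same rule at the same
-- match (the excluded case in the definition of a critical pair) we ask whether H₁ ≅ H₂, which that case implies.
... | no dependent with _≅?_ S H₁ H₂
...   | yes H₁≅H₂ = H₂ , isoStep (≅⇒Iso S H₁≅H₂) , isoStep (≅⇒Iso S (≅-refl S))
...   | no H₁≇H₂ = criticalPairCase S 𝒟 allSSC i j d₁ d₂ G∈𝒟 dependent H₁≇H₂
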